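{- Let $H=L(r_1,\dots,r_m)$ be a truncated parallelogram. Then $\mathbf{M}(H)\cong\mathbf{J}(\mathbf{F}(H))$.
   Context: Draw the regular hexagonal tiling so that each hexagon has two vertical edges; the right neighbor of a hexagon is the one sharing its right vertical edge, and its upper-left neighbor is the one sharing its upper-left slanted edge. For integers $r_1\ge\cdots\ge r_m\ge1$, $L(r_1,\dots,r_m)$ is the plane graph which is the union of hexagons $h_{ij}$ ($1\le i\le m$, $1\le j\le r_i$), where $h_{i,j+1}$ is the right neighbor of $h_{i,j}$ and $h_{i+1,1}$ is the upper-left neighbor of $h_{i,1}$. Its vertices are properly 2-colored so that the lowest vertex of each hexagon is white. $\mathbf{F}(H)$ is the poset on the hexagons with $h_{ij}\preceq h_{kl}$ iff $i\le k$ and $j\le l$. For a finite poset $\mathbf{P}$, $\mathbf{J}(\mathbf{P})$ is the lattice of order ideals ordered by inclusion. A 1-factor is a perfect matching, $\mathcal{M}(H)$ the set of them; for $M\in\mathcal{M}(H)$ a cycle is $M$-alternating if its edges alternate in/out of $M$, and proper if each of its edges in $M$ goes from white to black end-vertex along the clockwise orientation. $\vec Z(H)$ has vertex set $\mathcal{M}(H)$ and an arc $M_1\to M_2$ when $M_1\oplus M_2$ bounds an inner face and is a proper $M_1$-alternating cycle; $\mathbf{M}(H)$ is the poset on $\mathcal{M}(H)$ with $M_1\preceq M_2$ iff $\vec Z(H)$ has a directed path from $M_2$ to $M_1$. -}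

module Defs where

open import Data.Nat using (ℕ; suc; _≤_)
open import Data.Fin using (Fin; toℕ)
open import Data.Bool using (Bool; true; false; _xor_)
open import Data.Product using (Σ; ∃; _×_; _,_)
open import Data.Sum using (_⊎_)
open import Relation.Binary.PropositionalEquality using (_≡_; _≢_)
open import Relation.Binary.Construct.Closure.ReflexiveTransitive using (Star)
open import Function.Bundles using (_⇔_)

-- Coordinates on the hexagonal tiling (hexagons with two vertical edges).
--
-- Hexagon (x , y) has centre x·e₁ + y·e₂ where e₁ points to the right
-- neighbour and e₂ to the upper-left neighbour.  Every vertex of the
-- tiling is the lowest vertex of exactly one hexagon (these are the white
-- vertices) or the lower-left vertex of exactly one hexagon (black ones):
--   W a b = lowest vertex of hexagon (a , b)
--   B a b = lower-left vertex of hexagon (a , b)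
-- Then hexagon (x , y) has, in clockwise order starting at the top:
--   top = B (x+1) (y+1), upper-right = W (x+1) (y+1),
--   lower-right = B (x+1) y, bottom = W x y,
--   lower-left = B x y, upper-left = W x (y+1).
-- The 2-colouring W/B is proper and the lowest vertex of each hexagon is
-- white.

data Vtx : Set where
  W : ℕ → ℕ → Vtx
  B : ℕ → ℕ → Vtx

isWhite : Vtx → Bool
isWhite (W _ _) = true
isWhite (B _ _) = false

-- An edge is given by its white end-vertex coordinates and its black
-- end-vertex coordinates.
Edge : Set
Edge = (ℕ × ℕ) × (ℕ × ℕ)

-- the edge joining a white and a black vertex (the same-colour cases
-- never occur below and are junk)
join : Vtx → Vtx → Edge
join (W a b) (B c d) = (a , b) , (c , d)
join (B c d) (W a b) = (a , b) , (c , d)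
join (W a b) (W c d) = (a , b) , (c , d)
join (B a b) (B c d) = (a , b) , (c , d)

Incident : Vtx → Edge → Set
Incident v ((a , b) , (c , d)) = (v ≡ W a b) ⊎ (v ≡ B c d)

next : Fin 6 → Fin 6
next Fin.zero = Fin.suc Fin.zero
next (Fin.suc Fin.zero) = Fin.suc (Fin.suc Fin.zero)
next (Fin.suc (Fin.suc Fin.zero)) = Fin.suc (Fin.suc (Fin.suc Fin.zero))
next (Fin.suc (Fin.suc (Fin.suc Fin.zero))) = Fin.suc (Fin.suc (Fin.suc (Fin.suc Fin.zero)))
next (Fin.suc (Fin.suc (Fin.suc (Fin.suc Fin.zero)))) = Fin.suc (Fin.suc (Fin.suc (Fin.suc (Fin.suc Fin.zero))))
next (Fin.suc (Fin.suc (Fin.suc (Fin.suc (Fin.suc Fin.zero))))) = Fin.zero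

hexVtx : ℕ → ℕ → Fin 6 → Vtx
hexVtx x y Fin.zero = B (suc x) (suc y)
hexVtx x y (Fin.suc Fin.zero) = W (suc x) (suc y)
hexVtx x y (Fin.suc (Fin.suc Fin.zero)) = B (suc x) y
hexVtx x y (Fin.suc (Fin.suc (Fin.suc Fin.zero))) = W x y
hexVtx x y (Fin.suc (Fin.suc (Fin.suc (Fin.suc Fin.zero)))) = B x y
hexVtx x y (Fin.suc (Fin.suc (Fin.suc (Fin.suc (Fin.suc Fin.zero))))) = W x (suc y)

hexEdge : ℕ → ℕ → Fin 6 → Edge
hexEdge x y k = join (hexVtx x y k) (hexVtx x y (next k))

-- The truncated parallelogram H = L(r₁,…,r_m); row i (0-based) has r i
-- hexagons.  Hexagon h_{i+1,j+1} (0-based i , j) sits at (x , y) = (j , i).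

module L (m : ℕ) (r : Fin m → ℕ) where

  Hex : Set
  Hex = Σ (Fin m) (λ i → Fin (r i))

  _⊑_ : Hex → Hex → Set
  (i , j) ⊑ (k , l) = (toℕ i ≤ toℕ k) × (toℕ j ≤ toℕ l)

  vtxOf : Hex → Fin 6 → Vtx
  vtxOf (i , j) = hexVtx (toℕ j) (toℕ i)

  edgeOf : Hex → Fin 6 → Edge
  edgeOf (i , j) = hexEdge (toℕ j) (toℕ i)

  InV : Vtx → Set
  InV v = ∃ λ (h : Hex) → ∃ λ (k : Fin 6) → vtxOf h k ≡ v

  InE : Edge → Set
  InE e = ∃ λ (h : Hex) → ∃ λ (k : Fin 6) → edgeOf h k ≡ e

  record PerfectMatching : Set where
    field
      M      : Edge → Bool
      inH    : ∀ e → M e ≡ true → InE e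
      cover  : ∀ v → InV v → ∃ λ e → (M e ≡ true) × Incident v e
      unique : ∀ v → InV v → ∀ e e' → M e ≡ true → M e' ≡ true →
               Incident v e → Incident v e' → e ≡ e'
  open PerfectMatching public

  _≈M_ : PerfectMatching → PerfectMatching → Set
  M₁ ≈M M₂ = ∀ e → M M₁ e ≡ M M₂ e

  Alternating : PerfectMatching → Hex → Set
  Alternating M₁ h = ∀ k → M M₁ (edgeOf h k) ≢ M M₁ (edgeOf h (next k))

  Proper : PerfectMatching → Hex → Set
  Proper M₁ h = ∀ k → M M₁ (edgeOf h k) ≡ true → isWhite (vtxOf h k) ≡ true

  Arc : PerfectMatching → PerfectMatching → Set
  Arc M₁ M₂ = ∃ λ (h : Hex) →
    (∀ e → ((M M₁ e xor M M₂ e) ≡ true) ⇔ (∃ λ k → edgeOf h k ≡ e))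
    × Alternating M₁ h × Proper M₁ h

  -- the poset M(H): M₁ ≼ M₂ iff there is a directed path from M₂ to M₁
  -- in Z→(H) (vertices of Z→(H) are edge sets, identified up to ≈M)
  Step : PerfectMatching → PerfectMatching → Set
  Step M₁ M₂ = (M₁ ≈M M₂) ⊎ Arc M₁ M₂

  _≼_ : PerfectMatching → PerfectMatching → Set
  M₁ ≼ M₂ = Star Step M₂ M₁

  record Ideal : Set where
    field
      I    : Hex → Bool
      down : ∀ h h' → h' ⊑ h → I h ≡ true → I h' ≡ true
  open Ideal public

  _≈J_ : Ideal → Ideal → Set
  I₁ ≈J I₂ = ∀ h → I I₁ h ≡ I I₂ h

  _⊆J_ : Ideal → Ideal → Set
  I₁ ⊆J I₂ = ∀ h → I I₁ h ≡ true → I I₂ h ≡ true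

-- Label the faces of the grid ℕ × ℕ that contains H: a hexagon by its membership
-- in an ideal, faces on the two axes (left of and below H) true, all other faces
-- false.  An edge of H is matched when the labels of its two faces are equal, for
-- lower-left edges, or different, for the other edges.  Around every vertex the
-- labels of the three faces decrease, which leaves exactly one incident edge
-- matched.  Conversely a perfect matching recovers its labels from the parity of
-- the matched left edges along each row; walking along the zigzags between rows,
-- from the top row down, shows that the matching obeys the rule for these labels
-- and that they decrease, i.e. form an ideal.  Toggling a hexagon toggles exactly
-- its boundary; for a maximal hexagon of an ideal this boundary is a proper
-- alternating cycle, and conversely every arc of Z(H) removes one hexagon.

module Submission where

open import Defs
open import Data.Bool using (Bool; true; false; not; _∧_; _∨_; _xor_)
import Data.Bool.Properties as Bool
open import Data.Bool.Properties
  using (∨-comm; ∨-identityʳ; ∨-zeroʳ; ∧-zeroʳ; ∧-identityʳ; ∧-distribʳ-xor;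
         not-involutive; not-distribˡ-xor; xor-annihilates-not; xor-assoc; xor-comm)
open import Data.Empty using (⊥; ⊥-elim)
open import Data.Fin using (Fin; toℕ; fromℕ<)
open import Data.Fin.Patterns using (0F; 1F; 2F; 3F; 4F; 5F)
open import Data.Fin.Properties using (toℕ<n; fromℕ<-toℕ; toℕ-fromℕ<; toℕ-injective; any?)
open import Data.Maybe using (Maybe; just; nothing; maybe′)
open import Data.Maybe.Properties using (just-injective)
open import Data.Nat using (ℕ; zero; suc; pred; _+_; _≤_; _<_; z≤n; s≤s; _<?_; _≡ᵇ_)
open import Data.Nat.Properties
open import Data.Product using (Σ; ∃; _×_; _,_; proj₁; proj₂; uncurry)
open import Data.Sum using (_⊎_; inj₁; inj₂; [_,_]′)
open import Function using (_∘_)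
open import Function.Bundles using (_⇔_; Equivalence; mk⇔)
open import Relation.Binary.Construct.Closure.ReflexiveTransitive using (Star; ε; _◅_; _◅◅_)
open import Relation.Binary.Definitions using (tri<; tri≈; tri>)
open import Relation.Binary.Morphism.Structures using (IsOrderIsomorphism)
open import Relation.Binary.PropositionalEquality
open import Relation.Nullary using (¬_; yes; no; Dec; contradiction)

∨-true : ∀ {a b} → a ∨ b ≡ true → a ≡ true ⊎ b ≡ true
∨-true {true}  _ = inj₁ refl
∨-true {false} t = inj₂ t

∨-resolveˡ : ∀ {a b} → a ≡ false → a ∨ b ≡ true → b ≡ true
∨-resolveˡ refl t = t

∧-true : ∀ {a b} → a ∧ b ≡ true → a ≡ true × b ≡ true
∧-true {true} t = refl , t

∧-absorb : ∀ {a b} → (a ≡ true → b ≡ true) → a ∧ b ≡ a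
∧-absorb {true}  a⇒b = a⇒b refl
∧-absorb {false} _   = refl

xor⇒⊎ : ∀ {a b} → a xor b ≡ true → a ≡ true ⊎ b ≡ true
xor⇒⊎ {true}  _ = inj₁ refl
xor⇒⊎ {false} t = inj₂ t

xor-true : ∀ b → b xor true ≡ not b
xor-true true  = refl
xor-true false = refl

not-xor-true : ∀ b → not b xor true ≡ b
not-xor-true true  = refl
not-xor-true false = refl

xor-cancelˡ : ∀ a b → a xor (a xor b) ≡ b
xor-cancelˡ true  b = not-involutive b
xor-cancelˡ false b = refl

xor-cancel-outer : ∀ p b → (p xor b) xor p ≡ b
xor-cancel-outer true  true  = refl
xor-cancel-outer true  false = refl
xor-cancel-outer false true  = refl
xor-cancel-outer false false = refl

not-xor-cancel : ∀ a b → not a xor (b xor a) ≡ not b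
not-xor-cancel true  true  = refl
not-xor-cancel true  false = refl
not-xor-cancel false true  = refl
not-xor-cancel false false = refl

xor-cancel-middle : ∀ p q s → (p xor q) xor (q xor s) ≡ p xor s
xor-cancel-middle true  true  s = refl
xor-cancel-middle true  false s = refl
xor-cancel-middle false true  s = not-involutive s
xor-cancel-middle false false s = refl

xor-interchange : ∀ a b c d → (a xor c) xor (b xor d) ≡ (a xor b) xor (c xor d)
xor-interchange a b c d = begin
  (a xor c) xor (b xor d) ≡⟨ xor-assoc a c (b xor d) ⟩
  a xor (c xor (b xor d)) ≡⟨ cong (a xor_) (sym (xor-assoc c b d)) ⟩
  a xor ((c xor b) xor d) ≡⟨ cong (λ z → a xor (z xor d)) (xor-comm c b) ⟩
  a xor ((b xor c) xor d) ≡⟨ cong (a xor_) (xor-assoc b c d) ⟩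
  a xor (b xor (c xor d)) ≡⟨ sym (xor-assoc a b (c xor d)) ⟩
  (a xor b) xor (c xor d) ∎
  where open ≡-Reasoning

⇔-true : ∀ {a b} {A : Set} → a ≡ true ⇔ A → b ≡ true ⇔ A → a ≡ b
⇔-true {true}  {true}  _   _   = refl
⇔-true {false} {false} _   _   = refl
⇔-true {true}  {false} a⇔A b⇔A = sym (Equivalence.from b⇔A (Equivalence.to a⇔A refl))
⇔-true {false} {true}  a⇔A b⇔A = Equivalence.from a⇔A (Equivalence.to b⇔A refl)

none-of-three : false ≡ true ⊎ false ≡ true ⊎ false ≡ true → ⊥
none-of-three (inj₁ ())
none-of-three (inj₂ (inj₁ ()))
none-of-three (inj₂ (inj₂ ()))

maybe′-true : ∀ {A : Set} {f : A → Bool} {ma : Maybe A} →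
              maybe′ f false ma ≡ true → ∃ λ a → ma ≡ just a × f a ≡ true
maybe′-true {ma = just a} fa = a , refl , fa

≡ᵇ-refl : ∀ a → (a ≡ᵇ a) ≡ true
≡ᵇ-refl zero    = refl
≡ᵇ-refl (suc a) = ≡ᵇ-refl a

1+n≢ᵇn : ∀ a → (suc a ≡ᵇ a) ≡ false
1+n≢ᵇn zero    = refl
1+n≢ᵇn (suc a) = 1+n≢ᵇn a

n≢ᵇ1+n : ∀ a → (a ≡ᵇ suc a) ≡ false
n≢ᵇ1+n zero    = refl
n≢ᵇ1+n (suc a) = n≢ᵇ1+n a

≡ᵇ-true : ∀ {a b} → (a ≡ᵇ b) ≡ true → a ≡ b
≡ᵇ-true {zero}  {zero}  _  = refl
≡ᵇ-true {suc a} {suc b} eq = cong suc (≡ᵇ-true eq)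

exactlyOne : Bool → Bool → Bool → Bool
exactlyOne true  b     c = not (b ∨ c)
exactlyOne false true  c = not c
exactlyOne false false c = c

exactlyOne-intro : ∀ {a b c} → a ≡ true ⊎ b ≡ true ⊎ c ≡ true →
                   (a ≡ true → b ≡ true → ⊥) → (a ≡ true → c ≡ true → ⊥) →
                   (b ≡ true → c ≡ true → ⊥) → exactlyOne a b c ≡ true
exactlyOne-intro {true}  {true}          _ ab _  _  = ⊥-elim (ab refl refl)
exactlyOne-intro {true}  {false} {true}  _ _  ac _  = ⊥-elim (ac refl refl)
exactlyOne-intro {true}  {false} {false} _ _  _  _  = refl
exactlyOne-intro {false} {true}  {true}  _ _  _  bc = ⊥-elim (bc refl refl)
exactlyOne-intro {false} {true}  {false} _ _  _  _  = refl
exactlyOne-intro {false} {false} {true}  _ _  _  _  = refl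
exactlyOne-intro {false} {false} {false} (inj₁ ())        _ _ _
exactlyOne-intro {false} {false} {false} (inj₂ (inj₁ ())) _ _ _
exactlyOne-intro {false} {false} {false} (inj₂ (inj₂ ())) _ _ _

exactlyOne-some : ∀ {a b c} → exactlyOne a b c ≡ true → a ≡ true ⊎ b ≡ true ⊎ c ≡ true
exactlyOne-some {true}                _ = inj₁ refl
exactlyOne-some {false} {true}        _ = inj₂ (inj₁ refl)
exactlyOne-some {false} {false} {true} _ = inj₂ (inj₂ refl)

exactlyOne-¬₁₂ : ∀ {a b c} → a ≡ true → b ≡ true → exactlyOne a b c ≢ true
exactlyOne-¬₁₂ refl refl ()

exactlyOne-¬₁₃ : ∀ {a b c} → a ≡ true → c ≡ true → exactlyOne a b c ≢ true
exactlyOne-¬₁₃ {b = true}  refl refl ()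
exactlyOne-¬₁₃ {b = false} refl refl ()

exactlyOne-¬₂₃ : ∀ {a b c} → b ≡ true → c ≡ true → exactlyOne a b c ≢ true
exactlyOne-¬₂₃ {true}  refl refl ()
exactlyOne-¬₂₃ {false} refl refl ()

exactlyOne-≡ : ∀ {a b c a′ b′ c′} → a ≡ a′ → b ≡ b′ → c ≡ c′ →
               exactlyOne a′ b′ c′ ≡ true → exactlyOne a b c ≡ true
exactlyOne-≡ refl refl refl ex = ex

exactlyOne-xor : ∀ {a b c} → exactlyOne a b c ≡ true → a ≡ not (b xor c)
exactlyOne-xor {true}  {false} {false} _ = refl
exactlyOne-xor {false} {true}  {false} _ = refl
exactlyOne-xor {false} {false} {true}  _ = refl
exactlyOne-xor {true}  {true}          ()
exactlyOne-xor {true}  {false} {true}  ()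
exactlyOne-xor {false} {true}  {true}  ()
exactlyOne-xor {false} {false} {false} ()

exactlyOne-comm₁₂ : ∀ a b c → exactlyOne a b c ≡ exactlyOne b a c
exactlyOne-comm₁₂ true  true  c = refl
exactlyOne-comm₁₂ true  false c = refl
exactlyOne-comm₁₂ false true  c = refl
exactlyOne-comm₁₂ false false c = refl

exactlyOne-comm₂₃ : ∀ a b c → exactlyOne a b c ≡ exactlyOne a c b
exactlyOne-comm₂₃ true  b     c     = cong not (∨-comm b c)
exactlyOne-comm₂₃ false true  true  = refl
exactlyOne-comm₂₃ false true  false = refl
exactlyOne-comm₂₃ false false true  = refl
exactlyOne-comm₂₃ false false false = refl

mask-exactlyOne : ∀ {a b c a′ b′ c′} → exactlyOne a b c ≡ true →
                  (a ≡ true → a′ ≡ true) → (b ≡ true → b′ ≡ true) → (c ≡ true → c′ ≡ true) →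
                  exactlyOne (a ∧ a′) (b ∧ b′) (c ∧ c′) ≡ true
mask-exactlyOne {true}  {false} {false} _ a⇒ _  _  rewrite a⇒ refl = refl
mask-exactlyOne {false} {true}  {false} _ _  b⇒ _  rewrite b⇒ refl = refl
mask-exactlyOne {false} {false} {true}  _ _  _  c⇒ rewrite c⇒ refl = refl
mask-exactlyOne {true}  {true}          ()
mask-exactlyOne {true}  {false} {true}  ()
mask-exactlyOne {false} {true}  {true}  ()
mask-exactlyOne {false} {false} {false} ()

-- At a vertex whose three faces carry labels p, q, s, the three incident edges
-- are matched according to the rules not (p xor s), p xor q and q xor s.
record Coherent (p q s : Bool) : Set where
  constructor coherent
  field rules : exactlyOne (not (p xor s)) (p xor q) (q xor s) ≡ true

coherent-chain : ∀ {p q s} → (p ≡ true → q ≡ true) → (q ≡ true → s ≡ true) → Coherent p q s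
coherent-chain {true}  p⇒q q⇒s rewrite p⇒q refl | q⇒s refl = coherent refl
coherent-chain {false} {true}  _ q⇒s rewrite q⇒s refl = coherent refl
coherent-chain {false} {false} {true}  _ _ = coherent refl
coherent-chain {false} {false} {false} _ _ = coherent refl

coherent-false-false : ∀ s → Coherent false false s
coherent-false-false true  = coherent refl
coherent-false-false false = coherent refl

-- Coherence says that the middle label lies between the outer two.
coherent-∧ : ∀ {p q s} → Coherent p q s → p ≡ true → s ≡ true → q ≡ true
coherent-∧ {q = true}  _            _    _    = refl
coherent-∧ {q = false} (coherent ()) refl refl

coherent-∨ : ∀ {p q s} → Coherent p q s → q ≡ true → p ∨ s ≡ true
coherent-∨ {true}              _             _    = refl
coherent-∨ {false} {s = true}  _             _    = refl
coherent-∨ {false} {s = false} (coherent ()) refl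

rule-solve₁ : ∀ {a b c p q s} → exactlyOne a b c ≡ true →
              b ≡ p xor q → c ≡ q xor s → a ≡ not (p xor s)
rule-solve₁ {p = p} {q} {s} ex refl refl =
  trans (exactlyOne-xor ex) (cong not (xor-cancel-middle p q s))

rule-solve₂ : ∀ {a b c p q s} → exactlyOne a b c ≡ true →
              a ≡ not (p xor s) → c ≡ q xor s → b ≡ p xor q
rule-solve₂ {a} {b} {c} {p} {q} {s} ex refl refl =
  trans (exactlyOne-xor (trans (exactlyOne-comm₁₂ b a c) ex)) (solve p q s)
  where
  solve : ∀ p q s → not (not (p xor s) xor (q xor s)) ≡ p xor q
  solve true  true  true  = refl
  solve true  true  false = refl
  solve true  false true  = refl
  solve true  false false = refl
  solve false true  true  = refl
  solve false true  false = refl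
  solve false false true  = refl
  solve false false false = refl

rule-solve₃ : ∀ {a b c p q s} → exactlyOne a b c ≡ true →
              a ≡ not (p xor s) → b ≡ p xor q → c ≡ q xor s
rule-solve₃ {a} {b} {c} {p} {q} {s} ex refl refl =
  trans (exactlyOne-xor (trans (exactlyOne-comm₁₂ c a b) (trans (exactlyOne-comm₂₃ a c b) ex)))
        (solve p q s)
  where
  solve : ∀ p q s → not (not (p xor s) xor (p xor q)) ≡ q xor s
  solve true  true  true  = refl
  solve true  true  false = refl
  solve true  false true  = refl
  solve true  false false = refl
  solve false true  true  = refl
  solve false true  false = refl
  solve false false true  = refl
  solve false false false = refl

sumFin : ∀ n → (Fin n → ℕ) → ℕ
sumFin zero    f = 0
sumFin (suc n) f = f Fin.zero + sumFin n (λ k → f (Fin.suc k))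

sumFin-mono : ∀ n {f g : Fin n → ℕ} → (∀ k → f k ≤ g k) → sumFin n f ≤ sumFin n g
sumFin-mono zero    f≤g = z≤n
sumFin-mono (suc n) f≤g = +-mono-≤ (f≤g Fin.zero) (sumFin-mono n (λ k → f≤g (Fin.suc k)))

sumFin-strict : ∀ n {f g : Fin n → ℕ} → (∀ k → f k ≤ g k) → ∀ k₀ → f k₀ < g k₀ →
                sumFin n f < sumFin n g
sumFin-strict (suc n) f≤g Fin.zero     f<g =
  +-mono-<-≤ f<g (sumFin-mono n (λ k → f≤g (Fin.suc k)))
sumFin-strict (suc n) f≤g (Fin.suc k₀) f<g =
  +-mono-≤-< (f≤g Fin.zero) (sumFin-strict n (λ k → f≤g (Fin.suc k)) k₀ f<g)

greatest : ∀ {n} (P : Fin n → Set) → (∀ k → Dec (P k)) → ∃ P →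
           ∃ λ k → P k × (∀ k′ → P k′ → toℕ k′ ≤ toℕ k)
greatest {suc n} P P? (k , pk) with any? (λ k′ → P? (Fin.suc k′))
... | yes ∃P∘suc with greatest (λ k′ → P (Fin.suc k′)) (λ k′ → P? (Fin.suc k′)) ∃P∘suc
...   | k* , pk* , k*-max = Fin.suc k* , pk* , λ where
          Fin.zero      _  → z≤n
          (Fin.suc k′) pk′ → s≤s (k*-max k′ pk′)
greatest {suc n} P P? (Fin.zero , pk) | no ¬∃P∘suc = Fin.zero , pk , λ where
  Fin.zero      _  → z≤n
  (Fin.suc k′) pk′ → ⊥-elim (¬∃P∘suc (k′ , pk′))
greatest {suc n} P P? (Fin.suc k , pk) | no ¬∃P∘suc = ⊥-elim (¬∃P∘suc (k , pk))

indicator : Bool → ℕ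
indicator true  = 1
indicator false = 0

indicator-mono : ∀ {a b} → (a ≡ true → b ≡ true) → indicator a ≤ indicator b
indicator-mono {true}  a⇒b rewrite a⇒b refl = ≤-refl
indicator-mono {false} _   = z≤n

module Count {n : ℕ} (len : Fin n → ℕ) where

  Cell : Set
  Cell = Σ (Fin n) (λ i → Fin (len i))

  count : (Cell → Bool) → ℕ
  count φ = sumFin n (λ i → sumFin (len i) (λ j → indicator (φ (i , j))))

  count-strict : ∀ {φ ψ} → (∀ c → φ c ≡ true → ψ c ≡ true) →
                 ∀ c₀ → φ c₀ ≡ false → ψ c₀ ≡ true → count φ < count ψ
  count-strict φ⊆ψ (i₀ , j₀) φc₀ ψc₀ =
    sumFin-strict n (λ i → sumFin-mono (len i) (λ j → indicator-mono (φ⊆ψ (i , j)))) i₀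
      (sumFin-strict (len i₀) (λ j → indicator-mono (φ⊆ψ (i₀ , j))) j₀
        (subst₂ (λ a b → indicator a < indicator b) (sym φc₀) (sym ψc₀) ≤-refl))

downward-induction : ∀ (P : ℕ → Set) n → (∀ j → n ≤ j → P j) → (∀ j → P (suc j) → P j) →
                     ∀ j → P j
downward-induction P n base step j = go n j (m≤m+n n j)
  where
  go : ∀ d j → n ≤ d + j → P j
  go zero    j n≤j = base j n≤j
  go (suc d) j n≤d+1+j = step j (go d (suc j) (subst (n ≤_) (sym (+-suc d j)) n≤d+1+j))

-- Faces, edges and vertices of the hexagonal tiling

Labelling : Set
Labelling = ℕ → ℕ → Bool

isBorder : Labelling
isBorder zero    _       = true
isBorder (suc x) zero    = true
isBorder (suc x) (suc y) = false

Antitoneˣ Antitoneʸ : Labelling → Set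
Antitoneˣ g = ∀ x y → g (suc x) y ≡ true → g x y ≡ true
Antitoneʸ g = ∀ x y → g x (suc y) ≡ true → g x y ≡ true

antitoneˣ-≤ : ∀ {g} → Antitoneˣ g → ∀ {x x′ y} → x′ ≤ x → g x y ≡ true → g x′ y ≡ true
antitoneˣ-≤ ax {zero}  z≤n  t = t
antitoneˣ-≤ ax {suc x} x′≤x t with m≤n⇒m<n∨m≡n x′≤x
... | inj₁ x′<1+x = antitoneˣ-≤ ax (≤-pred x′<1+x) (ax x _ t)
... | inj₂ refl   = t

antitoneʸ-≤ : ∀ {g} → Antitoneʸ g → ∀ {x y y′} → y′ ≤ y → g x y ≡ true → g x y′ ≡ true
antitoneʸ-≤ ay {y = zero}  z≤n  t = t
antitoneʸ-≤ ay {y = suc y} y′≤y t with m≤n⇒m<n∨m≡n y′≤y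
... | inj₁ y′<1+y = antitoneʸ-≤ ay (≤-pred y′<1+y) (ay _ y t)
... | inj₂ refl   = t

-- Hexagon (x , y) of the tiling is the face (suc x , suc y) of the grid ℕ × ℕ,
-- and every edge is the lower-left, lower-right or left edge of exactly one
-- face.
lowerLeftEdge lowerRightEdge leftEdge : ℕ → ℕ → Edge
lowerLeftEdge  x y = (x , y) , (x , y)
lowerRightEdge x y = (x , y) , (suc x , y)
leftEdge       x y = (x , suc y) , (x , y)

data Shape : Edge → Set where
  lowerLeft  : ∀ x y → Shape (lowerLeftEdge x y)
  lowerRight : ∀ x y → Shape (lowerRightEdge x y)
  left       : ∀ x y → Shape (leftEdge x y)

data Offset (a : ℕ) : ℕ → Set where
  equal   : Offset a a
  plusOne : Offset a (suc a)
  other   : ∀ {c} → Offset a c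

offset : ∀ a c → Offset a c
offset zero    zero          = equal
offset zero    (suc zero)    = plusOne
offset zero    (suc (suc c)) = other
offset (suc a) zero          = other
offset (suc a) (suc c) with offset a c
... | equal   = equal
... | plusOne = plusOne
... | other   = other

offset-equal : ∀ a → offset a a ≡ equal
offset-equal zero    = refl
offset-equal (suc a) rewrite offset-equal a = refl

offset-plusOne : ∀ a → offset a (suc a) ≡ plusOne
offset-plusOne zero    = refl
offset-plusOne (suc a) rewrite offset-plusOne a = refl

shape? : (e : Edge) → Maybe (Shape e)
shape? ((a , b) , (c , d)) with offset a c | offset d b
... | equal   | equal   = just (lowerLeft a b)
... | plusOne | equal   = just (lowerRight a b)
... | equal   | plusOne = just (left a d)
... | _       | _       = nothing

shape?-complete : ∀ {e} (s : Shape e) → shape? e ≡ just s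
shape?-complete (lowerLeft x y)  rewrite offset-equal x   | offset-equal y   = refl
shape?-complete (lowerRight x y) rewrite offset-plusOne x | offset-equal y   = refl
shape?-complete (left x y)       rewrite offset-equal x   | offset-plusOne y = refl

-- Combine the labels of the two faces separated by an edge, the face to the
-- upper right first; _⊙_ is used for lower-left edges and _⊛_ for the others.
onShape : (Bool → Bool → Bool) → (Bool → Bool → Bool) → Labelling → ∀ {e} → Shape e → Bool
onShape _⊙_ _⊛_ g (lowerLeft x y)  = g (suc x) (suc y) ⊙ g x y
onShape _⊙_ _⊛_ g (lowerRight x y) = g (suc x) (suc y) ⊛ g (suc x) y
onShape _⊙_ _⊛_ g (left x y)       = g (suc x) (suc y) ⊛ g x (suc y)

onEdge : (Bool → Bool → Bool) → (Bool → Bool → Bool) → Labelling → Edge → Bool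
onEdge _⊙_ _⊛_ g e = maybe′ (onShape _⊙_ _⊛_ g) false (shape? e)

onEdge-shape : ∀ {_⊙_ _⊛_ g e} (s : Shape e) → onEdge _⊙_ _⊛_ g e ≡ onShape _⊙_ _⊛_ g s
onEdge-shape s rewrite shape?-complete s = refl

onEdge-true : ∀ {_⊙_ _⊛_ g} e → onEdge _⊙_ _⊛_ g e ≡ true → Shape e
onEdge-true e t with shape? e
... | just s = s

onEdge-cong : ∀ {_⊙_ _⊛_ g g′} → (∀ x y → g x y ≡ g′ x y) →
              ∀ e → onEdge _⊙_ _⊛_ g e ≡ onEdge _⊙_ _⊛_ g′ e
onEdge-cong {_⊙_} {_⊛_} {g} {g′} g≗g′ e with shape? e
... | nothing = refl
... | just (lowerLeft x y)  = cong₂ _⊙_ (g≗g′ (suc x) (suc y)) (g≗g′ x y)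
... | just (lowerRight x y) = cong₂ _⊛_ (g≗g′ (suc x) (suc y)) (g≗g′ (suc x) y)
... | just (left x y)       = cong₂ _⊛_ (g≗g′ (suc x) (suc y)) (g≗g′ x (suc y))

rule : Labelling → Edge → Bool
rule = onEdge (λ a b → not (a xor b)) _xor_

faceAt : ℕ × ℕ → Labelling
faceAt (a , b) x y = (x ≡ᵇ a) ∧ (y ≡ᵇ b)

faceAt-true : ∀ {a b x y} → faceAt (a , b) x y ≡ true → x ≡ a × y ≡ b
faceAt-true t with ∧-true t
... | x≡a , y≡b = ≡ᵇ-true x≡a , ≡ᵇ-true y≡b

rule-xor : ∀ g c e → rule (λ x y → g x y xor c x y) e ≡ rule g e xor onEdge _xor_ _xor_ c e
rule-xor g c e with shape? e
... | nothing = refl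
... | just (lowerLeft x y) = trans (cong not (xor-interchange (g (suc x) (suc y)) (g x y) _ _))
                                   (not-distribˡ-xor (g (suc x) (suc y) xor g x y) _)
... | just (lowerRight x y) = xor-interchange (g (suc x) (suc y)) (g (suc x) y) _ _
... | just (left x y)       = xor-interchange (g (suc x) (suc y)) (g x (suc y)) _ _

-- The three faces around a vertex, and its three edges: edge₁ separates hi
-- from lo, edge₂ hi from mid, edge₃ mid from lo (edge₃ is missing on the axes).
hi mid lo : Vtx → ℕ × ℕ
hi  (W x y) = suc x , suc y
hi  (B x y) = suc x , suc y
mid (W x y) = suc x , y
mid (B x y) = x , suc y
lo  (W x y) = x , y
lo  (B x y) = x , y

edge₁ edge₂ : Vtx → Edge
edge₁ (W x y) = lowerLeftEdge x y
edge₁ (B x y) = lowerLeftEdge x y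
edge₂ (W x y) = lowerRightEdge x y
edge₂ (B x y) = leftEdge x y

edge₃ : Vtx → Maybe Edge
edge₃ (W x zero)    = nothing
edge₃ (W x (suc y)) = just (leftEdge x y)
edge₃ (B zero y)    = nothing
edge₃ (B (suc x) y) = just (lowerRightEdge x y)

edge₃-true : ∀ {f : Edge → Bool} {v e} → edge₃ v ≡ just e → f e ≡ true →
             maybe′ f false (edge₃ v) ≡ true
edge₃-true eq t rewrite eq = t

StarEdge : Vtx → Edge → Set
StarEdge v e = e ≡ edge₁ v ⊎ e ≡ edge₂ v ⊎ edge₃ v ≡ just e

ExactlyOneAt : (Edge → Bool) → Vtx → Set
ExactlyOneAt f v = exactlyOne (f (edge₁ v)) (f (edge₂ v)) (maybe′ f false (edge₃ v)) ≡ true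

onEdge-edge₁ : ∀ {_⊙_ _⊛_ g} v → onEdge _⊙_ _⊛_ g (edge₁ v) ≡ uncurry g (hi v) ⊙ uncurry g (lo v)
onEdge-edge₁ (W x y) = onEdge-shape (lowerLeft x y)
onEdge-edge₁ (B x y) = onEdge-shape (lowerLeft x y)

onEdge-edge₂ : ∀ {_⊙_ _⊛_ g} v → onEdge _⊙_ _⊛_ g (edge₂ v) ≡ uncurry g (hi v) ⊛ uncurry g (mid v)
onEdge-edge₂ (W x y) = onEdge-shape (lowerRight x y)
onEdge-edge₂ (B x y) = onEdge-shape (left x y)

onEdge-edge₃ : ∀ {_⊙_ _⊛_ g} v {e} → edge₃ v ≡ just e →
               onEdge _⊙_ _⊛_ g e ≡ uncurry g (mid v) ⊛ uncurry g (lo v)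
onEdge-edge₃ (W x (suc y)) refl = onEdge-shape (left x y)
onEdge-edge₃ (B (suc x) y) refl = onEdge-shape (lowerRight x y)

star-incident : ∀ {v e} → StarEdge v e → Incident v e
star-incident {W x y}       (inj₁ refl)               = inj₁ refl
star-incident {B x y}       (inj₁ refl)               = inj₂ refl
star-incident {W x y}       (inj₂ (inj₁ refl))        = inj₁ refl
star-incident {B x y}       (inj₂ (inj₁ refl))        = inj₂ refl
star-incident {W x (suc y)} (inj₂ (inj₂ refl))        = inj₁ refl
star-incident {B (suc x) y} (inj₂ (inj₂ refl))        = inj₂ refl

incident-star : ∀ {v e} → Shape e → Incident v e → StarEdge v e
incident-star (lowerLeft x y)  (inj₁ refl) = inj₁ refl
incident-star (lowerLeft x y)  (inj₂ refl) = inj₁ refl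
incident-star (lowerRight x y) (inj₁ refl) = inj₂ (inj₁ refl)
incident-star (lowerRight x y) (inj₂ refl) = inj₂ (inj₂ refl)
incident-star (left x y)       (inj₁ refl) = inj₂ (inj₂ refl)
incident-star (left x y)       (inj₂ refl) = inj₂ (inj₁ refl)

edge₁≢edge₂ : ∀ v → edge₁ v ≢ edge₂ v
edge₁≢edge₂ (W x y) eq = 1+n≢n (sym (cong (proj₁ ∘ proj₂) eq))
edge₁≢edge₂ (B x y) eq = 1+n≢n (sym (cong (proj₂ ∘ proj₁) eq))

edge₃-distinct : ∀ v {e} → edge₃ v ≡ just e → edge₁ v ≢ e × edge₂ v ≢ e
edge₃-distinct (W x (suc y)) refl =
  (λ eq → 1+n≢n (cong (proj₂ ∘ proj₂) eq)) ,
  (λ eq → 1+n≢n (cong (proj₁ ∘ proj₂) eq))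
edge₃-distinct (B (suc x) y) refl =
  (λ eq → 1+n≢n (cong (proj₁ ∘ proj₁) eq)) ,
  (λ eq → 1+n≢n (cong (proj₁ ∘ proj₁) eq))

star-unique : ∀ {f v e e′} → ExactlyOneAt f v → StarEdge v e → StarEdge v e′ →
              f e ≡ true → f e′ ≡ true → e ≡ e′
star-unique ex (inj₁ refl) (inj₁ refl) _ _ = refl
star-unique ex (inj₂ (inj₁ refl)) (inj₂ (inj₁ refl)) _ _ = refl
star-unique {v = v} ex (inj₂ (inj₂ e₃)) (inj₂ (inj₂ e₃′)) _ _ =
  just-injective (trans (sym e₃) e₃′)
star-unique ex (inj₁ refl) (inj₂ (inj₁ refl)) t t′ = ⊥-elim (exactlyOne-¬₁₂ t t′ ex)
star-unique ex (inj₂ (inj₁ refl)) (inj₁ refl) t t′ = ⊥-elim (exactlyOne-¬₁₂ t′ t ex)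
star-unique {f} ex (inj₁ refl) (inj₂ (inj₂ e₃)) t t′ =
  ⊥-elim (exactlyOne-¬₁₃ t (edge₃-true {f} e₃ t′) ex)
star-unique {f} ex (inj₂ (inj₂ e₃)) (inj₁ refl) t t′ =
  ⊥-elim (exactlyOne-¬₁₃ t′ (edge₃-true {f} e₃ t) ex)
star-unique {f} {v} ex (inj₂ (inj₁ refl)) (inj₂ (inj₂ e₃)) t t′ =
  ⊥-elim (exactlyOne-¬₂₃ {f (edge₁ v)} t (edge₃-true {f} e₃ t′) ex)
star-unique {f} {v} ex (inj₂ (inj₂ e₃)) (inj₂ (inj₁ refl)) t t′ =
  ⊥-elim (exactlyOne-¬₂₃ {f (edge₁ v)} t′ (edge₃-true {f} e₃ t) ex)

hi⇒mid : ∀ {g} → Antitoneˣ g → Antitoneʸ g →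
         ∀ v → uncurry g (hi v) ≡ true → uncurry g (mid v) ≡ true
hi⇒mid ax ay (W x y) = ay (suc x) y
hi⇒mid ax ay (B x y) = ax x (suc y)

mid⇒lo : ∀ {g} → Antitoneˣ g → Antitoneʸ g →
         ∀ v → uncurry g (mid v) ≡ true → uncurry g (lo v) ≡ true
mid⇒lo ax ay (W x y) = ax x y
mid⇒lo ax ay (B x y) = ay x y

-- A labelling that is true on the axes, false on all high enough rows and
-- coherent around every vertex W x (suc y) is antitone: going down row by
-- row, coherence propagates monotonicity from the row above.
coherent⇒antitone : ∀ {g : Labelling} n →
  (∀ y → g zero y ≡ true) → (∀ x → g x zero ≡ true) →
  (∀ x y → n ≤ y → g (suc x) (suc y) ≡ false) →
  (∀ x y → Coherent (g (suc x) (suc (suc y))) (g (suc x) (suc y)) (g x (suc y))) →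
  Antitoneˣ g × Antitoneʸ g
coherent⇒antitone {g} n axisʸ axisˣ empty coh = (λ x y → rowAntitone y x) , columnAntitone
  where
  RowAntitone : ℕ → Set
  RowAntitone y = ∀ x → g (suc x) y ≡ true → g x y ≡ true

  module Below (y : ℕ) (above : RowAntitone (suc (suc y))) where
    mutual
      diagonal : ∀ x → g (suc x) (suc (suc y)) ≡ true → g x (suc y) ≡ true
      diagonal zero    _ = axisʸ (suc y)
      diagonal (suc x) t = vertical x (above (suc x) t)

      vertical : ∀ x → g (suc x) (suc (suc y)) ≡ true → g (suc x) (suc y) ≡ true
      vertical x t = coherent-∧ (coh x y) t (diagonal x t)

    horizontal : RowAntitone (suc y)
    horizontal zero    _ = axisʸ (suc y)
    horizontal (suc x) t with g (suc (suc x)) (suc (suc y)) in upper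
    ... | true  = diagonal (suc x) upper
    ... | false = ∨-resolveˡ upper (coherent-∨ (coh (suc x) y) t)

  rowAntitone : ∀ y → RowAntitone y
  rowAntitone = downward-induction RowAntitone (suc n) beyond step
    where
    beyond : ∀ y → suc n ≤ y → RowAntitone y
    beyond (suc y) (s≤s n≤y) x t = contradiction (trans (sym t) (empty x y n≤y)) λ ()
    step : ∀ y → RowAntitone (suc y) → RowAntitone y
    step zero    _     x _ = axisˣ x
    step (suc y) above = Below.horizontal y above

  columnAntitone : Antitoneʸ g
  columnAntitone zero    y       _ = axisʸ y
  columnAntitone (suc x) zero    _ = axisˣ (suc x)
  columnAntitone (suc x) (suc y) t = Below.vertical y (rowAntitone (suc (suc y))) x t

-- The next three lemmas concern the faces hi, mid, lo around a vertex: p, q, s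
-- are their labels, hp, hq, hs say whether they are hexagons of H, and bq, bs
-- whether mid and lo lie on an axis.  Each shows that an edge whose rule holds
-- lies in H.
equalEnds⇒inH : ∀ {p s hp hq hs bs} → (p ≡ true → hp ≡ true) → (hq ≡ true → hs ∨ bs ≡ true) →
                (bs ≡ true → s ≡ true) → hp ≡ true ⊎ hq ≡ true ⊎ hs ≡ true →
                not (p xor s) ≡ true → hp ∨ hs ≡ true
equalEnds⇒inH {hp = true}                              _    _   _    _    _  = refl
equalEnds⇒inH {hp = false} {hs = true}                 _    _   _    _    _  = refl
equalEnds⇒inH {true} {hp = false} {hs = false}         p⇒hp _   _    _    _  =
  contradiction (p⇒hp refl) λ ()
equalEnds⇒inH {false} {true} {hp = false} {hs = false} _    _   _    _    ()
equalEnds⇒inH {false} {false} {false} {true} {false}   _    hq⇒ bs⇒s _    _  =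
  contradiction (bs⇒s (hq⇒ refl)) λ ()
equalEnds⇒inH {false} {false} {false} {false} {false}  _    _   _    some _  =
  ⊥-elim (none-of-three some)

upperStep⇒inH : ∀ {p q hp hq hs bq bs} → (p ≡ true → q ≡ true) → (q ≡ true → hq ∨ bq ≡ true) →
                (bq ≡ true → bs ≡ true) → (bs ≡ true → hs ≡ false) →
                hp ≡ true ⊎ hq ≡ true ⊎ hs ≡ true → p xor q ≡ true → hp ∨ hq ≡ true
upperStep⇒inH {hp = true}                    _   _  _     _      _    _  = refl
upperStep⇒inH {hp = false} {true}            _   _  _     _      _    _  = refl
upperStep⇒inH {true} {true} {false} {false}  _   _  _     _      _    ()
upperStep⇒inH {true} {false} {false} {false} p⇒q _  _     _      _    _  =
  contradiction (p⇒q refl) λ ()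
upperStep⇒inH {false} {false} {false} {false} _  _  _     _      _    ()
upperStep⇒inH {false} {true} {false} {false} {false} _ _ _ _     some _  = ⊥-elim (none-of-three some)
upperStep⇒inH {false} {true} {false} {false} {true}  _ q⇒ bq⇒bs bs⇒¬hs _ _ =
  contradiction (bs⇒¬hs (bq⇒bs (q⇒ refl))) λ ()

lowerStep⇒inH : ∀ {q s hp hq hs bq} → (q ≡ true → s ≡ true) → (hp ≡ true → hq ∨ bq ≡ true) →
                (bq ≡ true → q ≡ true) → hp ≡ true ⊎ hq ≡ true ⊎ hs ≡ true →
                q xor s ≡ true → hq ∨ hs ≡ true
lowerStep⇒inH {hq = true}                            _   _   _    _    _  = refl
lowerStep⇒inH {hq = false} {hs = true}               _   _   _    _    _  = refl
lowerStep⇒inH {true} {true} {hq = false} {false}     _   _   _    _    ()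
lowerStep⇒inH {true} {false} {hq = false} {false}    q⇒s _   _    _    _  =
  contradiction (q⇒s refl) λ ()
lowerStep⇒inH {false} {false} {hq = false} {false}   _   _   _    _    ()
lowerStep⇒inH {false} {true} {false} {false} {false} _   _   _    some _  = ⊥-elim (none-of-three some)
lowerStep⇒inH {false} {true} {true} {false} {false}  _   hp⇒ bq⇒q _    _  =
  contradiction (bq⇒q (hp⇒ refl)) λ ()

module Matchings (m : ℕ) (r : Fin m → ℕ) where
  open L m r

  hexEdge-shape : ∀ x y k → Shape (hexEdge x y k)
  hexEdge-shape x y 0F = lowerLeft (suc x) (suc y)
  hexEdge-shape x y 1F = left (suc x) y
  hexEdge-shape x y 2F = lowerRight x y
  hexEdge-shape x y 3F = lowerLeft x y
  hexEdge-shape x y 4F = left x y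
  hexEdge-shape x y 5F = lowerRight x (suc y)

  InE⇒Shape : ∀ {e} → InE e → Shape e
  InE⇒Shape ((i , j) , k , refl) = hexEdge-shape (toℕ j) (toℕ i) k

  perfectMatching-exactlyOne : (P : PerfectMatching) → ∀ {v} → InV v → ExactlyOneAt (M P) v
  perfectMatching-exactlyOne P {v} v∈H = exactlyOne-intro some ¬₁₂ ¬₁₃ ¬₂₃
    where
    some : M P (edge₁ v) ≡ true ⊎ M P (edge₂ v) ≡ true ⊎ maybe′ (M P) false (edge₃ v) ≡ true
    some with cover P v v∈H
    ... | e , Me , e∋v with incident-star (InE⇒Shape (inH P e Me)) e∋v
    ...   | inj₁ refl        = inj₁ Me
    ...   | inj₂ (inj₁ refl) = inj₂ (inj₁ Me)
    ...   | inj₂ (inj₂ e₃)   = inj₂ (inj₂ (edge₃-true {M P} e₃ Me))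
    matched : ∀ {e e′} → StarEdge v e → StarEdge v e′ → M P e ≡ true → M P e′ ≡ true → e ≡ e′
    matched p p′ t t′ = unique P v v∈H _ _ t t′ (star-incident p) (star-incident p′)
    ¬₁₂ : M P (edge₁ v) ≡ true → M P (edge₂ v) ≡ true → ⊥
    ¬₁₂ t t′ = edge₁≢edge₂ v (matched (inj₁ refl) (inj₂ (inj₁ refl)) t t′)
    ¬₁₃ : M P (edge₁ v) ≡ true → maybe′ (M P) false (edge₃ v) ≡ true → ⊥
    ¬₁₃ t t₃ with maybe′-true t₃
    ... | e , e₃ , Me = proj₁ (edge₃-distinct v e₃) (matched (inj₁ refl) (inj₂ (inj₂ e₃)) t Me)
    ¬₂₃ : M P (edge₂ v) ≡ true → maybe′ (M P) false (edge₃ v) ≡ true → ⊥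
    ¬₂₃ t t₃ with maybe′-true t₃
    ... | e , e₃ , Me = proj₂ (edge₃-distinct v e₃) (matched (inj₂ (inj₁ refl)) (inj₂ (inj₂ e₃)) t Me)

  exactlyOne-perfectMatching : (f : Edge → Bool) → (∀ e → f e ≡ true → InE e) →
                               (∀ v → InV v → ExactlyOneAt f v) → PerfectMatching
  exactlyOne-perfectMatching f f⊆H ex = record
    { M      = f
    ; inH    = f⊆H
    ; cover  = λ v v∈H → witness v (exactlyOne-some (ex v v∈H))
    ; unique = λ v v∈H e e′ t t′ i i′ →
        star-unique (ex v v∈H) (incident-star (InE⇒Shape (f⊆H e t)) i)
                                (incident-star (InE⇒Shape (f⊆H e′ t′)) i′) t t′
    }
    where
    witness : ∀ v → f (edge₁ v) ≡ true ⊎ f (edge₂ v) ≡ true ⊎ maybe′ f false (edge₃ v) ≡ true →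
            ∃ λ e → (f e ≡ true) × Incident v e
    witness v (inj₁ t)        = edge₁ v , t , star-incident (inj₁ refl)
    witness v (inj₂ (inj₁ t)) = edge₂ v , t , star-incident (inj₂ (inj₁ refl))
    witness v (inj₂ (inj₂ t)) with maybe′-true t
    ... | e , e₃ , t′ = e , t′ , star-incident (inj₂ (inj₂ e₃))

module Staircase (m : ℕ) (r : Fin m → ℕ)
                 (r-antitone : ∀ i j → toℕ i ≤ toℕ j → r j ≤ r i)
                 (r-positive : ∀ i → 1 ≤ r i) where
  open L m r
  open Matchings m r

  column row : Hex → ℕ
  column (_ , j) = toℕ j
  row    (i , _) = toℕ i

  rowLength : ℕ → ℕ
  rowLength y with y <? m
  ... | yes y<m = r (fromℕ< y<m)
  ... | no  _   = 0

  rowLength-fromℕ< : ∀ {y} (y<m : y < m) → rowLength y ≡ r (fromℕ< y<m)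
  rowLength-fromℕ< {y} y<m with y <? m
  ... | yes _    = refl
  ... | no  y≮m  = ⊥-elim (y≮m y<m)

  rowLength-outside : ∀ {y} → ¬ y < m → rowLength y ≡ 0
  rowLength-outside {y} y≮m with y <? m
  ... | yes y<m = ⊥-elim (y≮m y<m)
  ... | no  _   = refl

  rowLength-row : ∀ h → rowLength (row h) ≡ r (proj₁ h)
  rowLength-row (i , _) = trans (rowLength-fromℕ< (toℕ<n i)) (cong r (fromℕ<-toℕ i (toℕ<n i)))

  rowLength-antitone : ∀ {y y′} → y′ ≤ y → rowLength y ≤ rowLength y′
  rowLength-antitone {y} {y′} y′≤y with y <? m | y′ <? m
  ... | yes y<m | yes y′<m = r-antitone (fromℕ< y′<m) (fromℕ< y<m)
                               (subst₂ _≤_ (sym (toℕ-fromℕ< y′<m)) (sym (toℕ-fromℕ< y<m)) y′≤y)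
  ... | yes y<m | no  y′≮m = ⊥-elim (y′≮m (≤-<-trans y′≤y y<m))
  ... | no  _   | _        = z≤n

  rowLength-positive : ∀ {y} → y < m → 0 < rowLength y
  rowLength-positive y<m rewrite rowLength-fromℕ< y<m = r-positive _

  rowLength-nonempty : ∀ {x y} → x < rowLength y → y < m
  rowLength-nonempty {y = y} x<len with y <? m
  ... | yes y<m = y<m

  data HexAt (x y : ℕ) : Maybe Hex → Set where
    hexagon : ∀ h → column h ≡ x → row h ≡ y → HexAt x y (just h)
    none    : rowLength y ≤ x → HexAt x y nothing

  hexAt : ℕ → ℕ → Maybe Hex
  hexAt x y with y <? m
  ... | no  _   = nothing
  ... | yes y<m with x <? r (fromℕ< y<m)
  ...   | no  _   = nothing
  ...   | yes x<r = just (fromℕ< y<m , fromℕ< x<r)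

  hexAt-view : ∀ x y → HexAt x y (hexAt x y)
  hexAt-view x y with y <? m
  ... | no y≮m = none (subst (_≤ x) (sym (rowLength-outside y≮m)) z≤n)
  ... | yes y<m with x <? r (fromℕ< y<m)
  ...   | no  x≮r = none (subst (_≤ x) (sym (rowLength-fromℕ< y<m)) (≮⇒≥ x≮r))
  ...   | yes x<r = hexagon _ (toℕ-fromℕ< x<r) (toℕ-fromℕ< y<m)

  column<rowLength : ∀ h → column h < rowLength (row h)
  column<rowLength h@(_ , j) = subst (toℕ j <_) (sym (rowLength-row h)) (toℕ<n j)

  hexAt-coordinates : ∀ h → hexAt (column h) (row h) ≡ just h
  hexAt-coordinates h with hexAt (column h) (row h) | hexAt-view (column h) (row h)
  ... | just h′ | hexagon _ col row′ = cong just (coordinates-injective col row′)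
    where
    coordinates-injective : ∀ {h h′} → column h′ ≡ column h → row h′ ≡ row h → h′ ≡ h
    coordinates-injective {i , j} {i′ , j′} col row′ with toℕ-injective row′
    ... | refl = cong (i ,_) (toℕ-injective col)
  ... | nothing | none len≤col = ⊥-elim (<⇒≱ (column<rowLength h) len≤col)

  hexagonAt : ∀ {x y} → x < rowLength y → Σ Hex λ h → column h ≡ x × row h ≡ y
  hexagonAt {x} {y} x<len with hexAt x y | hexAt-view x y
  ... | just h  | hexagon _ col row′ = h , col , row′
  ... | nothing | none len≤x        = ⊥-elim (<⇒≱ x<len len≤x)

  corner : ∀ {x y} → x < rowLength y → ∀ k → InV (hexVtx x y k)
  corner x<len k with hexagonAt x<len
  ... | h , refl , refl = h , k , refl

  -- W x k and B (x+1) k are corners of hexagon (x , k-1), or of hexagon (x , 0) when k = 0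
  lowerCorners : ∀ k {x} → x < rowLength (pred k) → InV (W x k) × InV (B (suc x) k)
  lowerCorners zero    x<len = corner x<len 3F , corner x<len 2F
  lowerCorners (suc j) x<len = corner x<len 5F , corner x<len 0F

  upperRightCorner : ∀ {x y} → 0 < x → x ≤ rowLength y → InV (W x (suc y))
  upperRightCorner {suc x} _ x<len = corner x<len 1F

  label : (Hex → Bool) → Labelling
  label φ zero    y       = true
  label φ (suc x) zero    = true
  label φ (suc x) (suc y) = maybe′ φ false (hexAt x y)

  isHex : Labelling
  isHex zero    _       = false
  isHex (suc x) zero    = false
  isHex (suc x) (suc y) = label (λ _ → true) (suc x) (suc y)

  label-hex : ∀ φ h → label φ (suc (column h)) (suc (row h)) ≡ φ h
  label-hex φ h rewrite hexAt-coordinates h = refl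

  label-at : ∀ φ {x y} h → column h ≡ x → row h ≡ y → label φ (suc x) (suc y) ≡ φ h
  label-at φ h refl refl = label-hex φ h

  label-beyond : ∀ φ {x y} → rowLength y ≤ x → label φ (suc x) (suc y) ≡ false
  label-beyond φ {x} {y} len≤x with hexAt x y | hexAt-view x y
  ... | just h  | hexagon _ refl refl = ⊥-elim (<⇒≱ (column<rowLength h) len≤x)
  ... | nothing | _                   = refl

  label-true : ∀ φ {x y} → label φ (suc x) (suc y) ≡ true →
               Σ Hex λ h → column h ≡ x × row h ≡ y × φ h ≡ true
  label-true φ {x} {y} t with hexAt x y | hexAt-view x y
  ... | just h  | hexagon _ col row′ = h , col , row′ , t

  label-inside : ∀ φ {x y} → label φ (suc x) (suc y) ≡ true → x < rowLength y
  label-inside φ t with label-true φ t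
  ... | h , refl , refl , _ = column<rowLength h

  isHex-hex : ∀ h → isHex (suc (column h)) (suc (row h)) ≡ true
  isHex-hex = label-hex (λ _ → true)

  isHex-inside : ∀ {x y} → isHex (suc x) (suc y) ≡ true → x < rowLength y
  isHex-inside = label-inside (λ _ → true)

  isHex-beyond : ∀ {x y} → rowLength y ≤ x → isHex (suc x) (suc y) ≡ false
  isHex-beyond = label-beyond (λ _ → true)

  inside-isHex : ∀ {x y} → x < rowLength y → isHex (suc x) (suc y) ≡ true
  inside-isHex x<len with hexagonAt x<len
  ... | h , refl , refl = isHex-hex h

  label-cong : ∀ {φ ψ} → (∀ h → φ h ≡ ψ h) → ∀ x y → label φ x y ≡ label ψ x y
  label-cong φ≗ψ zero    y       = refl
  label-cong φ≗ψ (suc x) zero    = refl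
  label-cong φ≗ψ (suc x) (suc y) with hexAt x y
  ... | just h  = φ≗ψ h
  ... | nothing = refl

  DownClosed : (Hex → Bool) → Set
  DownClosed φ = ∀ h h′ → h′ ⊑ h → φ h ≡ true → φ h′ ≡ true

  label-antitoneˣ : ∀ {φ} → DownClosed φ → Antitoneˣ (label φ)
  label-antitoneˣ     φ↓ zero    y       _ = refl
  label-antitoneˣ     φ↓ (suc x) zero    _ = refl
  label-antitoneˣ {φ} φ↓ (suc x) (suc y) t with label-true φ t
  ... | h , col , row-h , φh with hexagonAt (<-trans (n<1+n x) (label-inside φ t))
  ...   | h′ , col′ , row′ = trans (label-at φ h′ col′ row′)
          (φ↓ h h′ (≤-reflexive (trans row′ (sym row-h)) ,
                    subst₂ _≤_ (sym col′) (sym col) (n≤1+n x)) φh)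

  label-antitoneʸ : ∀ {φ} → DownClosed φ → Antitoneʸ (label φ)
  label-antitoneʸ     φ↓ zero    y       _ = refl
  label-antitoneʸ     φ↓ (suc x) zero    _ = refl
  label-antitoneʸ {φ} φ↓ (suc x) (suc y) t with label-true φ t
  ... | h , col , row-h , φh with hexagonAt (<-≤-trans (label-inside φ t) (rowLength-antitone (n≤1+n y)))
  ...   | h′ , col′ , row′ = trans (label-at φ h′ col′ row′)
          (φ↓ h h′ (subst₂ _≤_ (sym row′) (sym row-h) (n≤1+n y) ,
                    ≤-reflexive (trans col′ (sym col))) φh)

  antitone⇒downClosed : ∀ {φ} → Antitoneˣ (label φ) → Antitoneʸ (label φ) → DownClosed φ
  antitone⇒downClosed {φ} ax ay h h′ (row≤ , col≤) φh =
    trans (sym (label-hex φ h′))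
          (antitoneˣ-≤ ax (s≤s col≤) (antitoneʸ-≤ ay (s≤s row≤) (trans (label-hex φ h) φh)))

  -- The perfect matching of an ideal

  inHᵇ : Edge → Bool
  inHᵇ = onEdge _∨_ _∨_ isHex

  matchingValue : Labelling → Edge → Bool
  matchingValue g e = rule g e ∧ inHᵇ e

  hexEdge∈H : ∀ {x y} → isHex (suc x) (suc y) ≡ true → ∀ k → InE (hexEdge x y k)
  hexEdge∈H t k with hexagonAt (label-inside _ t)
  ... | h , refl , refl = h , k , refl

  inHᵇ⇒InE : ∀ e → inHᵇ e ≡ true → InE e
  inHᵇ⇒InE e t = faces (onEdge-true e t) (trans (sym (onEdge-shape (onEdge-true e t))) t)
    where
    faces : ∀ {e} (s : Shape e) → onShape _∨_ _∨_ isHex s ≡ true → InE e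
    faces (lowerLeft x y) t with ∨-true {isHex (suc x) (suc y)} t
    ... | inj₁ t₁ = hexEdge∈H t₁ 3F
    faces (lowerLeft (suc x) (suc y)) t | inj₂ t₂ = hexEdge∈H t₂ 0F
    faces (lowerRight x y) t with ∨-true {isHex (suc x) (suc y)} t
    ... | inj₁ t₁ = hexEdge∈H t₁ 2F
    faces (lowerRight x (suc y)) t | inj₂ t₂ = hexEdge∈H t₂ 5F
    faces (left x y) t with ∨-true {isHex (suc x) (suc y)} t
    ... | inj₁ t₁ = hexEdge∈H t₁ 4F
    faces (left (suc x) y) t | inj₂ t₂ = hexEdge∈H t₂ 1F

  InE⇒inHᵇ : ∀ {e} → InE e → inHᵇ e ≡ true
  InE⇒inHᵇ (h , k , refl) = trans (onEdge-shape (hexEdge-shape (column h) (row h) k)) (sides k)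
    where
    X Y : ℕ
    X = column h
    Y = row h
    sides : ∀ k → onShape _∨_ _∨_ isHex (hexEdge-shape X Y k) ≡ true
    sides 0F rewrite hexAt-coordinates h = ∨-zeroʳ (isHex (suc (suc X)) (suc (suc Y)))
    sides 1F rewrite hexAt-coordinates h = ∨-zeroʳ (isHex (suc (suc X)) (suc Y))
    sides 2F rewrite hexAt-coordinates h = refl
    sides 3F rewrite hexAt-coordinates h = refl
    sides 4F rewrite hexAt-coordinates h = refl
    sides 5F rewrite hexAt-coordinates h = ∨-zeroʳ (isHex (suc X) (suc (suc Y)))

  unmatched-outside : ∀ (P : PerfectMatching) e → inHᵇ e ≡ false → M P e ≡ false
  unmatched-outside P e e∉H with M P e in matched
  ... | false = refl
  ... | true  = contradiction (trans (sym e∉H) (InE⇒inHᵇ (inH P e matched))) λ ()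

  matchingValue-boundary : ∀ g h k → matchingValue g (edgeOf h k) ≡
                           onShape (λ a b → not (a xor b)) _xor_ g (hexEdge-shape (column h) (row h) k)
  matchingValue-boundary g h k =
    trans (cong₂ _∧_ (onEdge-shape (hexEdge-shape (column h) (row h) k)) (InE⇒inHᵇ (h , k , refl)))
          (∧-identityʳ _)

  matchingValue-left : ∀ g {x y} → x < rowLength y →
                       matchingValue g (leftEdge x y) ≡ g (suc x) (suc y) xor g x (suc y)
  matchingValue-left g {x} {y} x<len =
    trans (cong₂ _∧_ (onEdge-shape (left x y))
                     (trans (onEdge-shape (left x y)) (cong (_∨ isHex x (suc y)) (inside-isHex x<len))))
          (∧-identityʳ _)

  border⇒label : ∀ φ f → uncurry isBorder f ≡ true → uncurry (label φ) f ≡ true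
  border⇒label φ (zero  , y)    _ = refl
  border⇒label φ (suc x , zero) _ = refl

  border⇒¬hex : ∀ f → uncurry isBorder f ≡ true → uncurry isHex f ≡ false
  border⇒¬hex (zero  , y)    _ = refl
  border⇒¬hex (suc x , zero) _ = refl

  label⇒isHex : ∀ φ {x y} → label φ (suc x) (suc y) ≡ true → isHex (suc x) (suc y) ≡ true
  label⇒isHex φ t with label-true φ t
  ... | h , refl , refl , _ = label-hex (λ _ → true) h

  label⇒hex∨border : ∀ φ f → uncurry (label φ) f ≡ true → uncurry isHex f ∨ uncurry isBorder f ≡ true
  label⇒hex∨border φ (zero  , y)     _ = refl
  label⇒hex∨border φ (suc x , zero)  _ = refl
  label⇒hex∨border φ (suc x , suc y) t = trans (∨-identityʳ _) (label⇒isHex φ t)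

  isHex⇒region : ∀ f → uncurry isHex f ≡ true → uncurry (label (λ _ → true)) f ≡ true
  isHex⇒region (suc x , suc y) t = t

  region-antitoneˣ : Antitoneˣ (label (λ _ → true))
  region-antitoneˣ = label-antitoneˣ (λ _ _ _ _ → refl)

  region-antitoneʸ : Antitoneʸ (label (λ _ → true))
  region-antitoneʸ = label-antitoneʸ (λ _ _ _ _ → refl)

  hex-hi⇒mid : ∀ v → uncurry isHex (hi v) ≡ true → uncurry isHex (mid v) ∨ uncurry isBorder (mid v) ≡ true
  hex-hi⇒mid v t =
    label⇒hex∨border _ (mid v) (hi⇒mid region-antitoneˣ region-antitoneʸ v (isHex⇒region (hi v) t))

  hex-mid⇒lo : ∀ v → uncurry isHex (mid v) ≡ true → uncurry isHex (lo v) ∨ uncurry isBorder (lo v) ≡ true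
  hex-mid⇒lo v t =
    label⇒hex∨border _ (lo v) (mid⇒lo region-antitoneˣ region-antitoneʸ v (isHex⇒region (mid v) t))

  label-hi⇒hex : ∀ φ v → uncurry (label φ) (hi v) ≡ true → uncurry isHex (hi v) ≡ true
  label-hi⇒hex φ (W x y) = label⇒isHex φ
  label-hi⇒hex φ (B x y) = label⇒isHex φ

  border-mid⇒lo : ∀ v → uncurry isBorder (mid v) ≡ true → uncurry isBorder (lo v) ≡ true
  border-mid⇒lo (W zero    zero)    _ = refl
  border-mid⇒lo (W (suc x) zero)    _ = refl
  border-mid⇒lo (B zero    y)       _ = refl

  star-hexagon : ∀ {v} → InV v →
    uncurry isHex (hi v) ≡ true ⊎ uncurry isHex (mid v) ≡ true ⊎ uncurry isHex (lo v) ≡ true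
  star-hexagon (h , 0F , refl) = inj₂ (inj₂ (label-hex (λ _ → true) h))
  star-hexagon (h , 1F , refl) = inj₂ (inj₂ (label-hex (λ _ → true) h))
  star-hexagon (h , 2F , refl) = inj₂ (inj₁ (label-hex (λ _ → true) h))
  star-hexagon (h , 3F , refl) = inj₁ (label-hex (λ _ → true) h)
  star-hexagon (h , 4F , refl) = inj₁ (label-hex (λ _ → true) h)
  star-hexagon (h , 5F , refl) = inj₂ (inj₁ (label-hex (λ _ → true) h))

  edge₃-matchingValue : ∀ φ v → maybe′ (matchingValue (label φ)) false (edge₃ v) ≡
    (uncurry (label φ) (mid v) xor uncurry (label φ) (lo v)) ∧ (uncurry isHex (mid v) ∨ uncurry isHex (lo v))
  edge₃-matchingValue φ (W zero    zero)    = refl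
  edge₃-matchingValue φ (W (suc x) zero)    = refl
  edge₃-matchingValue φ (W x       (suc y)) =
    cong₂ _∧_ (onEdge-edge₃ (W x (suc y)) refl) (onEdge-edge₃ (W x (suc y)) refl)
  edge₃-matchingValue φ (B zero    y)       = refl
  edge₃-matchingValue φ (B (suc x) y)       =
    cong₂ _∧_ (onEdge-edge₃ (B (suc x) y) refl) (onEdge-edge₃ (B (suc x) y) refl)

  ideal-exactlyOne : ∀ J {v} → InV v → ExactlyOneAt (matchingValue (label (I J))) v
  ideal-exactlyOne J {v} v∈H =
    exactlyOne-≡ (cong₂ _∧_ (onEdge-edge₁ v) (onEdge-edge₁ v)) (cong₂ _∧_ (onEdge-edge₂ v) (onEdge-edge₂ v))
                 (edge₃-matchingValue (I J) v)
      (mask-exactlyOne (Coherent.rules (coherent-chain p⇒q q⇒s)) edge₁∈H edge₂∈H edge₃∈H)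
    where
    p q s hp hq hs : Bool
    p  = uncurry (label (I J)) (hi v)
    q  = uncurry (label (I J)) (mid v)
    s  = uncurry (label (I J)) (lo v)
    hp = uncurry isHex (hi v)
    hq = uncurry isHex (mid v)
    hs = uncurry isHex (lo v)
    p⇒q : p ≡ true → q ≡ true
    p⇒q = hi⇒mid (label-antitoneˣ (down J)) (label-antitoneʸ (down J)) v
    q⇒s : q ≡ true → s ≡ true
    q⇒s = mid⇒lo (label-antitoneˣ (down J)) (label-antitoneʸ (down J)) v
    edge₁∈H : not (p xor s) ≡ true → hp ∨ hs ≡ true
    edge₁∈H = equalEnds⇒inH (label-hi⇒hex (I J) v) (hex-mid⇒lo v) (border⇒label (I J) (lo v))
                            (star-hexagon v∈H)
    edge₂∈H : p xor q ≡ true → hp ∨ hq ≡ true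
    edge₂∈H = upperStep⇒inH p⇒q (label⇒hex∨border (I J) (mid v)) (border-mid⇒lo v) (border⇒¬hex (lo v))
                            (star-hexagon v∈H)
    edge₃∈H : q xor s ≡ true → hq ∨ hs ≡ true
    edge₃∈H = lowerStep⇒inH q⇒s (hex-hi⇒mid v) (border⇒label (I J) (mid v)) (star-hexagon v∈H)

  matchingOf : Ideal → PerfectMatching
  matchingOf J = exactlyOne-perfectMatching (matchingValue (label (I J)))
                   (λ e t → inHᵇ⇒InE e (proj₂ (∧-true t))) (λ v → ideal-exactlyOne J)

  matchingOf-cong : ∀ {J K} → J ≈J K → matchingOf J ≈M matchingOf K
  matchingOf-cong J≈K e = cong (_∧ inHᵇ e) (onEdge-cong (label-cong J≈K) e)

  -- The ideal of a perfect matching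

  module FromMatching (P : PerfectMatching) where

    parity : ℕ → ℕ → Bool
    parity zero    y = M P (leftEdge zero y)
    parity (suc x) y = parity x y xor M P (leftEdge (suc x) y)

    member : Hex → Bool
    member h = not (parity (column h) (row h))

    g : Labelling
    g = label member

    g-inside : ∀ {x y} → x < rowLength y → g (suc x) (suc y) ≡ not (parity x y)
    g-inside x<len with hexagonAt x<len
    ... | h , refl , refl = label-hex member h

    g-beyond : ∀ {x y} → rowLength y ≤ x → g (suc x) (suc y) ≡ false
    g-beyond = label-beyond member

    Follows₁ Follows₂ Follows₃ : Vtx → Set
    Follows₁ v = M P (edge₁ v) ≡ not (uncurry g (hi v) xor uncurry g (lo v))
    Follows₂ v = M P (edge₂ v) ≡ uncurry g (hi v) xor uncurry g (mid v)
    Follows₃ v = maybe′ (M P) false (edge₃ v) ≡ uncurry g (mid v) xor uncurry g (lo v)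

    -- This is Follows₂ (B x y), and also Follows₃ (W x (suc y)).
    LeftFollows : ℕ → ℕ → Set
    LeftFollows x y = M P (leftEdge x y) ≡ g (suc x) (suc y) xor g x (suc y)

    follows₁ : ∀ {v} → InV v → Follows₂ v → Follows₃ v → Follows₁ v
    follows₁ {v} v∈H = rule-solve₁ {p = uncurry g (hi v)} {uncurry g (mid v)} {uncurry g (lo v)}
                                   (perfectMatching-exactlyOne P v∈H)

    follows₂ : ∀ {v} → InV v → Follows₁ v → Follows₃ v → Follows₂ v
    follows₂ {v} v∈H = rule-solve₂ {p = uncurry g (hi v)} {uncurry g (mid v)} {uncurry g (lo v)}
                                   (perfectMatching-exactlyOne P v∈H)

    follows₃ : ∀ {v} → InV v → Follows₁ v → Follows₂ v → Follows₃ v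
    follows₃ {v} v∈H = rule-solve₃ {p = uncurry g (hi v)} {uncurry g (mid v)} {uncurry g (lo v)}
                                   (perfectMatching-exactlyOne P v∈H)

    left-interior : ∀ {x y} → x < rowLength y → LeftFollows x y
    left-interior {zero}  {y} 0<len rewrite g-inside 0<len = sym (not-xor-true (M P (leftEdge zero y)))
    left-interior {suc x} {y} x<len rewrite g-inside x<len | g-inside (<-trans (n<1+n x) x<len) = sym (begin
      not (parity (suc x) y) xor not (parity x y)        ≡⟨ xor-annihilates-not (parity (suc x) y) _ ⟩
      (parity x y xor M P (leftEdge (suc x) y)) xor parity x y ≡⟨ xor-cancel-outer (parity x y) _ ⟩
      M P (leftEdge (suc x) y)                           ∎)
      where open ≡-Reasoning

    left-beyond : ∀ {x y} → rowLength y ≤ x → LeftFollows (suc x) y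
    left-beyond {x} {y} len≤x rewrite g-beyond (≤-trans len≤x (n≤1+n x)) | g-beyond len≤x =
      unmatched-outside P (leftEdge (suc x) y)
        (trans (onEdge-shape (left (suc x) y))
               (cong₂ _∨_ (isHex-beyond (≤-trans len≤x (n≤1+n x))) (isHex-beyond len≤x)))

    lowerLeft-axis : ∀ y → Follows₁ (B zero y)
    lowerLeft-axis y = byRow (y <? m)
      where
      byRow : Dec (y < m) → Follows₁ (B zero y)
      byRow (yes y<m) =
        follows₁ (corner (rowLength-positive y<m) 4F) (left-interior (rowLength-positive y<m)) refl
      byRow (no y≮m) rewrite g-beyond {zero} {y} (≤-reflexive (rowLength-outside y≮m)) =
        unmatched-outside P (lowerLeftEdge zero y)
          (trans (onEdge-shape (lowerLeft zero y))
                 (cong (_∨ false) (isHex-beyond (≤-reflexive (rowLength-outside y≮m)))))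

    -- Walking along the zigzag at height k (the bottom of row k) from left to
    -- right, the rule at each vertex determines the next edge.
    module Zigzag (k : ℕ) (lefts : ∀ x → LeftFollows (suc x) k)
                  (below : ∀ x → x < rowLength (pred k) → Follows₃ (W x k)) where

      mutual
        lowerLeftFollows : ∀ x → x ≤ rowLength (pred k) → Follows₁ (B x k)
        lowerLeftFollows zero    _    = lowerLeft-axis k
        lowerLeftFollows (suc x) x<len =
          follows₁ (proj₂ (lowerCorners k x<len)) (lefts x) (lowerRightFollows x x<len)

        lowerRightFollows : ∀ x → x < rowLength (pred k) → Follows₂ (W x k)
        lowerRightFollows x x<len =
          follows₂ (proj₁ (lowerCorners k x<len)) (lowerLeftFollows x (<⇒≤ x<len)) (below x x<len)

    below-axis : ∀ x → Follows₃ (W x zero)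
    below-axis zero    = refl
    below-axis (suc x) = refl

    last-left : ∀ {y} → y < m → (∀ x → LeftFollows (suc x) (suc y)) → LeftFollows (rowLength y) y
    last-left {y} y<m lefts =
      follows₃ (upperRightCorner (rowLength-positive y<m) ≤-refl) (lowerLeftFollows (rowLength y) ≤-refl)
               outsideRight
      where
      open Zigzag (suc y) lefts (λ x → left-interior)
      len↑≤len : rowLength (suc y) ≤ rowLength y
      len↑≤len = rowLength-antitone (n≤1+n y)
      outsideRight : Follows₂ (W (rowLength y) (suc y))
      outsideRight rewrite g-beyond len↑≤len | g-beyond {rowLength y} {y} ≤-refl =
        unmatched-outside P (lowerRightEdge (rowLength y) (suc y))
          (trans (onEdge-shape (lowerRight (rowLength y) (suc y)))
                 (cong₂ _∨_ (isHex-beyond len↑≤len) (isHex-beyond {rowLength y} {y} ≤-refl)))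

    -- The last left edge of row y is reached along the zigzag above row y, which
    -- needs the left edges of row y+1: the induction runs from the top row down.
    leftFollows : ∀ y x → LeftFollows (suc x) y
    leftFollows = downward-induction (λ y → ∀ x → LeftFollows (suc x) y) m outside step
      where
      outside : ∀ y → m ≤ y → ∀ x → LeftFollows (suc x) y
      outside y m≤y x = left-beyond (subst (_≤ x) (sym (rowLength-outside (≤⇒≯ m≤y))) z≤n)
      step : ∀ y → (∀ x → LeftFollows (suc x) (suc y)) → ∀ x → LeftFollows (suc x) y
      step y above x with <-cmp (suc x) (rowLength y)
      ... | tri< x<len _ _ = left-interior x<len
      ... | tri≈ _ x≡len _ = subst (λ z → LeftFollows z y) (sym x≡len)
                               (last-left (rowLength-nonempty (subst (0 <_) x≡len (s≤s z≤n))) above)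
      ... | tri> _ _ len<x = left-beyond (≤-pred len<x)

    module Zigzag₀ = Zigzag zero (leftFollows zero) (λ x _ → below-axis x)
    module Zigzag₊ (y : ℕ) = Zigzag (suc y) (leftFollows (suc y)) (λ x → left-interior)

    follows-shape : ∀ {e} (s : Shape e) → onShape _∨_ _∨_ isHex s ≡ true →
                    M P e ≡ onShape (λ a b → not (a xor b)) _xor_ g s
    follows-shape (left zero y) t = left-interior (isHex-inside (trans (sym (∨-identityʳ _)) t))
    follows-shape (left (suc x) y) _ = leftFollows y x
    follows-shape (lowerLeft x zero) t with ∨-true {isHex (suc x) 1} t
    ... | inj₁ t₁ = Zigzag₀.lowerLeftFollows x (<⇒≤ (isHex-inside t₁))
    follows-shape (lowerLeft zero    zero) t | inj₂ ()
    follows-shape (lowerLeft (suc x) zero) t | inj₂ ()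
    follows-shape (lowerLeft x (suc y)) t with ∨-true {isHex (suc x) (suc (suc y))} t
    ... | inj₁ t₁ = Zigzag₊.lowerLeftFollows y x
                      (<⇒≤ (<-≤-trans (isHex-inside t₁) (rowLength-antitone (n≤1+n y))))
    follows-shape (lowerLeft (suc x) (suc y)) t | inj₂ t₂ = Zigzag₊.lowerLeftFollows y (suc x) (isHex-inside t₂)
    follows-shape (lowerLeft zero    (suc y)) t | inj₂ ()
    follows-shape (lowerRight x zero) t with ∨-true {isHex (suc x) 1} t
    ... | inj₁ t₁ = Zigzag₀.lowerRightFollows x (isHex-inside t₁)
    ... | inj₂ ()
    follows-shape (lowerRight x (suc y)) t with ∨-true {isHex (suc x) (suc (suc y))} t
    ... | inj₁ t₁ = Zigzag₊.lowerRightFollows y x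
                      (<-≤-trans (isHex-inside t₁) (rowLength-antitone (n≤1+n y)))
    ... | inj₂ t₂ = Zigzag₊.lowerRightFollows y x (isHex-inside t₂)

    matching-determined : ∀ e → M P e ≡ matchingValue g e
    matching-determined e with inHᵇ e in e∈H
    ... | false = trans (unmatched-outside P e e∈H) (sym (∧-zeroʳ (rule g e)))
    ... | true  = trans (follows-shape s (trans (sym (onEdge-shape s)) e∈H))
                        (trans (sym (onEdge-shape s)) (sym (∧-identityʳ (rule g e))))
      where
      s : Shape e
      s = onEdge-true e e∈H

    coherent-above : ∀ x y → Coherent (g (suc x) (suc (suc y))) (g (suc x) (suc y)) (g x (suc y))
    coherent-above x y = byColumn (x <? rowLength y)
      where
      byColumn : Dec (x < rowLength y) → Coherent (g (suc x) (suc (suc y))) (g (suc x) (suc y)) (g x (suc y))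
      byColumn (yes x<len) = coherent (exactlyOne-≡ (sym (Zigzag₊.lowerLeftFollows y x (<⇒≤ x<len)))
                                                    (sym (Zigzag₊.lowerRightFollows y x x<len))
                                                    (sym (left-interior x<len))
                                                    (perfectMatching-exactlyOne P (corner x<len 5F)))
      byColumn (no x≮len) rewrite g-beyond (≮⇒≥ x≮len)
                                | g-beyond (≤-trans (rowLength-antitone (n≤1+n y)) (≮⇒≥ x≮len)) =
        coherent-false-false (g x (suc y))

    member-antitone : Antitoneˣ g × Antitoneʸ g
    member-antitone = coherent⇒antitone m (λ _ → refl) axisˣ emptyRows coherent-above
      where
      axisˣ : ∀ x → g x zero ≡ true
      axisˣ zero    = refl
      axisˣ (suc x) = refl
      emptyRows : ∀ x y → m ≤ y → g (suc x) (suc y) ≡ false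
      emptyRows x y m≤y = g-beyond (subst (_≤ x) (sym (rowLength-outside (≤⇒≯ m≤y))) z≤n)

    idealOf : Ideal
    idealOf = record
      { I    = member
      ; down = antitone⇒downClosed (proj₁ member-antitone) (proj₂ member-antitone)
      }

  open FromMatching public using (idealOf; matching-determined)

  parity-cong : ∀ {P P′} → P ≈M P′ → ∀ x y → FromMatching.parity P x y ≡ FromMatching.parity P′ x y
  parity-cong P≈P′ zero    y = P≈P′ (leftEdge zero y)
  parity-cong P≈P′ (suc x) y = cong₂ _xor_ (parity-cong P≈P′ x y) (P≈P′ (leftEdge (suc x) y))

  idealOf-cong : ∀ {P P′} → P ≈M P′ → idealOf P ≈J idealOf P′
  idealOf-cong P≈P′ h = cong not (parity-cong P≈P′ (column h) (row h))

  idealOf-injective : ∀ {P P′} → idealOf P ≈J idealOf P′ → P ≈M P′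
  idealOf-injective {P} {P′} f≈f′ e = begin
    M P e                                         ≡⟨ matching-determined P e ⟩
    matchingValue (label (I (idealOf P))) e       ≡⟨ cong (_∧ inHᵇ e) (onEdge-cong (label-cong f≈f′) e) ⟩
    matchingValue (label (I (idealOf P′))) e      ≡⟨ matching-determined P′ e ⟨
    M P′ e                                        ∎
    where open ≡-Reasoning

  parity-labelled : ∀ P φ → (∀ e → M P e ≡ matchingValue (label φ) e) →
                    ∀ {x y} → x < rowLength y → FromMatching.parity P x y ≡ not (label φ (suc x) (suc y))
  parity-labelled P φ P≡φ {zero}  x<len =
    trans (P≡φ _) (trans (matchingValue-left (label φ) x<len) (xor-true _))
  parity-labelled P φ P≡φ {suc x} {y} x<len = begin
    parity x y xor M P (leftEdge (suc x) y)
      ≡⟨ cong₂ _xor_ (parity-labelled P φ P≡φ (<-trans (n<1+n x) x<len))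
                     (trans (P≡φ _) (matchingValue-left g x<len)) ⟩
    not (g (suc x) (suc y)) xor (g (suc (suc x)) (suc y) xor g (suc x) (suc y))
      ≡⟨ not-xor-cancel (g (suc x) (suc y)) _ ⟩
    not (g (suc (suc x)) (suc y))
      ∎
    where
    open ≡-Reasoning
    open FromMatching P using (parity)
    g : Labelling
    g = label φ

  idealOf-labelled : ∀ P φ → (∀ e → M P e ≡ matchingValue (label φ) e) →
                     ∀ h → I (idealOf P) h ≡ φ h
  idealOf-labelled P φ P≡φ h = begin
    not (FromMatching.parity P (column h) (row h))       ≡⟨ cong not (parity-labelled P φ P≡φ (column<rowLength h)) ⟩
    not (not (label φ (suc (column h)) (suc (row h))))   ≡⟨ not-involutive _ ⟩
    label φ (suc (column h)) (suc (row h))               ≡⟨ label-hex φ h ⟩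
    φ h                                                  ∎
    where open ≡-Reasoning

  idealOf-matchingOf : ∀ J → idealOf (matchingOf J) ≈J J
  idealOf-matchingOf J = idealOf-labelled (matchingOf J) (I J) (λ _ → refl)

  -- Toggling a maximal hexagon

  sameHex : Hex → Hex → Bool
  sameHex h h′ = (column h′ ≡ᵇ column h) ∧ (row h′ ≡ᵇ row h)

  sameHex-refl : ∀ h → sameHex h h ≡ true
  sameHex-refl h rewrite ≡ᵇ-refl (column h) | ≡ᵇ-refl (row h) = refl

  sameHex-true : ∀ {h h′} → sameHex h h′ ≡ true → h′ ≡ h
  sameHex-true {i , j} {i′ , j′} t with faceAt-true {toℕ j} {toℕ i} {toℕ j′} {toℕ i′} t
  ... | col , row′ with toℕ-injective row′
  ...   | refl = cong (i ,_) (toℕ-injective col)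

  _⊕_ : (Hex → Bool) → Hex → Hex → Bool
  (φ ⊕ h) h′ = φ h′ xor sameHex h h′

  faceOf : Hex → ℕ × ℕ
  faceOf h = suc (column h) , suc (row h)

  label-⊕ : ∀ φ h x y → label (φ ⊕ h) x y ≡ label φ x y xor faceAt (faceOf h) x y
  label-⊕ φ h zero    y       = refl
  label-⊕ φ h (suc x) zero    = cong (true xor_) (sym (∧-zeroʳ (x ≡ᵇ column h)))
  label-⊕ φ h (suc x) (suc y) with hexAt x y | hexAt-view x y
  ... | just h′ | hexagon _ refl refl = refl
  ... | nothing | none len≤x with faceAt (faceOf h) (suc x) (suc y) in onH
  ...   | false = refl
  ...   | true with faceAt-true {suc (column h)} {suc (row h)} {suc x} {suc y} onH
  ...     | refl , refl = ⊥-elim (<⇒≱ (column<rowLength h) len≤x)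

  boundaryᵇ : Hex → Edge → Bool
  boundaryᵇ h = onEdge _xor_ _xor_ (faceAt (faceOf h))

  boundaryᵇ⇔ : ∀ h e → boundaryᵇ h e ≡ true ⇔ (∃ λ k → edgeOf h k ≡ e)
  boundaryᵇ⇔ h e = mk⇔ (λ t → sides (onEdge-true e t) (trans (sym (onEdge-shape (onEdge-true e t))) t))
                       (λ { (k , refl) → trans (onEdge-shape (hexEdge-shape X Y k)) (boundary k) })
    where
    X Y : ℕ
    X = column h
    Y = row h
    sides : ∀ {e} (s : Shape e) → onShape _xor_ _xor_ (faceAt (faceOf h)) s ≡ true →
            ∃ λ k → edgeOf h k ≡ e
    sides (lowerLeft x y) t with xor⇒⊎ t
    ... | inj₁ t₁ with faceAt-true {suc X} {suc Y} {suc x} {suc y} t₁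
    ...   | refl , refl = 3F , refl
    sides (lowerLeft x y) t | inj₂ t₂ with faceAt-true {suc X} {suc Y} {x} {y} t₂
    ...   | refl , refl = 0F , refl
    sides (lowerRight x y) t with xor⇒⊎ t
    ... | inj₁ t₁ with faceAt-true {suc X} {suc Y} {suc x} {suc y} t₁
    ...   | refl , refl = 2F , refl
    sides (lowerRight x y) t | inj₂ t₂ with faceAt-true {suc X} {suc Y} {suc x} {y} t₂
    ...   | refl , refl = 5F , refl
    sides (left x y) t with xor⇒⊎ t
    ... | inj₁ t₁ with faceAt-true {suc X} {suc Y} {suc x} {suc y} t₁
    ...   | refl , refl = 4F , refl
    sides (left x y) t | inj₂ t₂ with faceAt-true {suc X} {suc Y} {x} {suc y} t₂
    ...   | refl , refl = 1F , refl
    boundary : ∀ k → onShape _xor_ _xor_ (faceAt (faceOf h)) (hexEdge-shape X Y k) ≡ true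
    boundary 0F rewrite 1+n≢ᵇn X | ≡ᵇ-refl X | ≡ᵇ-refl Y = refl
    boundary 1F rewrite 1+n≢ᵇn X | ≡ᵇ-refl X | ≡ᵇ-refl Y = refl
    boundary 2F rewrite ≡ᵇ-refl X | ≡ᵇ-refl Y | n≢ᵇ1+n Y = refl
    boundary 3F rewrite ≡ᵇ-refl X | ≡ᵇ-refl Y | n≢ᵇ1+n X = refl
    boundary 4F rewrite ≡ᵇ-refl X | ≡ᵇ-refl Y | n≢ᵇ1+n X = refl
    boundary 5F rewrite ≡ᵇ-refl X | ≡ᵇ-refl Y | 1+n≢ᵇn Y = refl

  matchingValue-⊕ : ∀ φ h e →
                    matchingValue (label (φ ⊕ h)) e ≡ matchingValue (label φ) e xor boundaryᵇ h e
  matchingValue-⊕ φ h e = begin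
    rule (label (φ ⊕ h)) e ∧ inHᵇ e
      ≡⟨ cong (_∧ inHᵇ e) (onEdge-cong (label-⊕ φ h) e) ⟩
    rule (λ x y → label φ x y xor faceAt (faceOf h) x y) e ∧ inHᵇ e
      ≡⟨ cong (_∧ inHᵇ e) (rule-xor (label φ) (faceAt (faceOf h)) e) ⟩
    (rule (label φ) e xor boundaryᵇ h e) ∧ inHᵇ e
      ≡⟨ ∧-distribʳ-xor (inHᵇ e) (rule (label φ) e) (boundaryᵇ h e) ⟩
    matchingValue (label φ) e xor (boundaryᵇ h e ∧ inHᵇ e)
      ≡⟨ cong (matchingValue (label φ) e xor_) (∧-absorb boundary⇒inH) ⟩
    matchingValue (label φ) e xor boundaryᵇ h e
      ∎
    where
    open ≡-Reasoning
    boundary⇒inH : boundaryᵇ h e ≡ true → inHᵇ e ≡ true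
    boundary⇒inH t with Equivalence.to (boundaryᵇ⇔ h e) t
    ... | k , refl = InE⇒inHᵇ (h , k , refl)

  colours-alternate : ∀ x y k → isWhite (hexVtx x y k) ≢ isWhite (hexVtx x y (next k))
  colours-alternate x y 0F ()
  colours-alternate x y 1F ()
  colours-alternate x y 2F ()
  colours-alternate x y 3F ()
  colours-alternate x y 4F ()
  colours-alternate x y 5F ()

  Maximal : Ideal → Hex → Set
  Maximal J h = I J h ≡ true × (∀ h′ → h ⊑ h′ → I J h′ ≡ true → h′ ≡ h)

  -- Around a maximal hexagon of J the faces below are labelled true and those
  -- above false, so exactly the boundary edges leaving a white vertex clockwise
  -- are matched.
  maximal-boundary : ∀ {J h} → Maximal J h → ∀ k → M (matchingOf J) (edgeOf h k) ≡ isWhite (vtxOf h k)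
  maximal-boundary {J} {h} (J∋h , maximal) k = trans (matchingValue-boundary g h k) (values k)
    where
    X Y : ℕ
    X = column h
    Y = row h
    g : Labelling
    g = label (I J)
    own : g (suc X) (suc Y) ≡ true
    own = trans (label-hex (I J) h) J∋h
    left′ : g X (suc Y) ≡ true
    left′ = label-antitoneˣ (down J) X (suc Y) own
    below : g (suc X) Y ≡ true
    below = label-antitoneʸ (down J) (suc X) Y own
    diagonal : g X Y ≡ true
    diagonal = label-antitoneʸ (down J) X Y left′
    above : ∀ {x y} → X ≤ x → Y ≤ y → X < x ⊎ Y < y → g (suc x) (suc y) ≡ false
    above {x} {y} X≤x Y≤y strict with g (suc x) (suc y) in t
    ... | false = refl
    ... | true with label-true (I J) t
    ...   | h′ , refl , refl , J∋h′ with maximal h′ (Y≤y , X≤x) J∋h′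
    ...     | refl = ⊥-elim ([ <-irrefl refl , <-irrefl refl ]′ strict)
    values : ∀ k → onShape (λ a b → not (a xor b)) _xor_ g (hexEdge-shape X Y k) ≡ isWhite (hexVtx X Y k)
    values 0F rewrite above (n≤1+n X) (n≤1+n Y) (inj₁ ≤-refl) | own = refl
    values 1F rewrite above (n≤1+n X) ≤-refl (inj₁ ≤-refl) | own = refl
    values 2F rewrite own | below = refl
    values 3F rewrite own | diagonal = refl
    values 4F rewrite own | left′ = refl
    values 5F rewrite above ≤-refl (n≤1+n Y) (inj₂ ≤-refl) | own = refl

  remove : (J : Ideal) (h : Hex) → Maximal J h → Ideal
  remove J h (J∋h , maximal) = record { I = I J ⊕ h ; down = down′ }
    where
    down′ : ∀ h₁ h₂ → h₂ ⊑ h₁ → (I J ⊕ h) h₁ ≡ true → (I J ⊕ h) h₂ ≡ true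
    down′ h₁ h₂ h₂⊑h₁ t with I J h₁ in J∋h₁ | sameHex h h₁ in h₁≟h
    ... | false | true  with sameHex-true {h} {h₁} h₁≟h
    ...   | refl = contradiction (trans (sym J∋h) J∋h₁) λ ()
    down′ h₁ h₂ h₂⊑h₁ t | true | false with sameHex h h₂ in h₂≟h
    ... | false = cong (_xor false) (down J h₁ h₂ h₂⊑h₁ J∋h₁)
    ... | true with sameHex-true {h} {h₂} h₂≟h
    ...   | refl = contradiction (trans (sym (sameHex-refl h))
                                        (subst (λ h′ → sameHex h h′ ≡ false) (maximal h₁ h₂⊑h₁ J∋h₁) h₁≟h))
                                 λ ()

  flip : ∀ J h (h-max : Maximal J h) → Arc (matchingOf J) (matchingOf (remove J h h-max))
  flip J h h-max = h , differ , alternating , proper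
    where
    differ : ∀ e → (M (matchingOf J) e xor M (matchingOf (remove J h h-max)) e ≡ true) ⇔
                   (∃ λ k → edgeOf h k ≡ e)
    differ e = subst (λ b → (b ≡ true) ⇔ (∃ λ k → edgeOf h k ≡ e))
                     (sym (trans (cong (matchingValue (label (I J)) e xor_) (matchingValue-⊕ (I J) h e))
                                 (xor-cancelˡ (matchingValue (label (I J)) e) (boundaryᵇ h e))))
                     (boundaryᵇ⇔ h e)
    alternating : Alternating (matchingOf J) h
    alternating k eq = colours-alternate (column h) (row h) k
      (trans (sym (maximal-boundary {J} {h} h-max k)) (trans eq (maximal-boundary {J} {h} h-max (next k))))
    proper : Proper (matchingOf J) h
    proper k t = trans (sym (maximal-boundary {J} {h} h-max k)) t

  arc-toggles : ∀ {P₁ P₂} (arc : Arc P₁ P₂) →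
                ∀ h′ → I (idealOf P₂) h′ ≡ (I (idealOf P₁) ⊕ proj₁ arc) h′
  arc-toggles {P₁} {P₂} (h , differ , _) = idealOf-labelled P₂ (φ₁ ⊕ h) P₂-labelled
    where
    φ₁ : Hex → Bool
    φ₁ = I (idealOf P₁)
    P₂-labelled : ∀ e → M P₂ e ≡ matchingValue (label (φ₁ ⊕ h)) e
    P₂-labelled e = begin
      M P₂ e                                        ≡⟨ xor-cancelˡ (M P₁ e) (M P₂ e) ⟨
      M P₁ e xor (M P₁ e xor M P₂ e)                ≡⟨ cong₂ _xor_ (matching-determined P₁ e)
                                                                   (⇔-true (differ e) (boundaryᵇ⇔ h e)) ⟩
      matchingValue (label φ₁) e xor boundaryᵇ h e  ≡⟨ matchingValue-⊕ φ₁ h e ⟨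
      matchingValue (label (φ₁ ⊕ h)) e              ∎
      where open ≡-Reasoning

  -- Otherwise both faces at the top edge of h would be labelled false, so that
  -- edge would be matched although its clockwise start is black.
  arc-hexagon∈ : ∀ {P₁ P₂} (arc : Arc P₁ P₂) → I (idealOf P₁) (proj₁ arc) ≡ true
  arc-hexagon∈ {P₁} (h , _ , _ , proper) with I (idealOf P₁) h in h∉₁
  ... | true  = refl
  ... | false = contradiction (proper 0F topMatched) λ ()
    where
    X Y : ℕ
    X = column h
    Y = row h
    g : Labelling
    g = label (I (idealOf P₁))
    own : g (suc X) (suc Y) ≡ false
    own = trans (label-hex _ h) h∉₁
    upper : g (suc (suc X)) (suc (suc Y)) ≡ false
    upper with g (suc (suc X)) (suc (suc Y)) in t
    ... | false = refl
    ... | true  = contradiction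
      (trans (sym own) (label-antitoneʸ (down (idealOf P₁)) (suc X) (suc Y)
                          (label-antitoneˣ (down (idealOf P₁)) (suc X) (suc (suc Y)) t))) λ ()
    topMatched : M P₁ (edgeOf h 0F) ≡ true
    topMatched rewrite matching-determined P₁ (edgeOf h 0F) | matchingValue-boundary g h 0F
                     | upper | own = refl

  arc-shrinks : ∀ {P₁ P₂} → Arc P₁ P₂ → idealOf P₂ ⊆J idealOf P₁
  arc-shrinks {P₁} {P₂} arc h′ h′∈₂
    with xor⇒⊎ {I (idealOf P₁) h′} (trans (sym (arc-toggles {P₁} {P₂} arc h′)) h′∈₂)
  ... | inj₁ h′∈₁ = h′∈₁
  ... | inj₂ h′≟h with sameHex-true {proj₁ arc} {h′} h′≟h
  ...   | refl = arc-hexagon∈ {P₁} {P₂} arc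

  -- The highest row meeting J ∖ K, and in it the rightmost hexagon of J.
  maximal-outside : ∀ J K → K ⊆J J → ∀ {h₀} → I J h₀ ∧ not (I K h₀) ≡ true →
                    ∃ λ h → Maximal J h × I K h ≡ false
  maximal-outside J K K⊆J {i₀ , j₀} out₀
    with greatest (λ i → ∃ λ j → I J (i , j) ∧ not (I K (i , j)) ≡ true)
                  (λ i → any? (λ j → I J (i , j) ∧ not (I K (i , j)) Bool.≟ true)) (i₀ , j₀ , out₀)
  ... | i* , (j₁ , out₁) , rowMax
    with greatest (λ j → I J (i* , j) ≡ true) (λ j → I J (i* , j) Bool.≟ true) (j₁ , proj₁ (∧-true out₁))
  ...   | j* , J∋h , colMax = (i* , j*) , (J∋h , maximal) , K∌h
    where
    h : Hex
    h = i* , j*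
    K∌h : I K h ≡ false
    K∌h with I K h in K∋h
    ... | false = refl
    ... | true  = contradiction
      (trans (sym (cong not (down K h (i* , j₁) (≤-refl , colMax j₁ (proj₁ (∧-true out₁))) K∋h)))
             (proj₂ (∧-true out₁))) λ ()
    maximal : ∀ h′ → h ⊑ h′ → I J h′ ≡ true → h′ ≡ h
    maximal (i′ , j′) (i*≤i′ , j*≤j′) J∋h′ with I K (i′ , j′) in K∋h′
    ... | true  = contradiction (trans (sym (down K (i′ , j′) h (i*≤i′ , j*≤j′) K∋h′)) K∌h) λ ()
    ... | false with toℕ-injective (≤-antisym (rowMax i′ (j′ , cong₂ _∧_ J∋h′ (cong not K∋h′))) i*≤i′)
    ...   | refl = cong (i* ,_) (toℕ-injective (≤-antisym (colMax j′ J∋h′) j*≤j′))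

  open Count r using (count; count-strict)

  -- Removing maximal hexagons of J outside K one at a time, each removal being a
  -- flip, leads from the matching of J down to that of K.
  flips : ∀ n J K → K ⊆J J → count (I J) ≤ n → Star Step (matchingOf J) (matchingOf K)
  flips n J K K⊆J size≤n with any? (λ i → any? (λ j → (I J (i , j) ∧ not (I K (i , j))) Bool.≟ true))
  ... | no J⊆K = inj₁ (matchingOf-cong {J} {K} J≈K) ◅ ε
    where
    J≈K : J ≈J K
    J≈K (i , j) with I J (i , j) in J∋ | I K (i , j) in K∋
    ... | true  | true  = refl
    ... | false | false = refl
    ... | true  | false = ⊥-elim (J⊆K (i , j , cong₂ _∧_ J∋ (cong not K∋)))
    ... | false | true  = contradiction (trans (sym (K⊆J _ K∋)) J∋) λ ()
  ... | yes (i , j , out) with maximal-outside J K K⊆J {i , j} out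
  ...   | h , h-max@(J∋h , _) , K∌h = inj₂ (flip J h h-max) ◅ rest n size≤n
    where
    J′ : Ideal
    J′ = remove J h h-max
    J′⊆J : ∀ h′ → I J′ h′ ≡ true → I J h′ ≡ true
    J′⊆J h′ t with xor⇒⊎ {I J h′} t
    ... | inj₁ J∋h′ = J∋h′
    ... | inj₂ h′≟h with sameHex-true {h} {h′} h′≟h
    ...   | refl = J∋h
    J′∌h : I J′ h ≡ false
    J′∌h rewrite J∋h | sameHex-refl h = refl
    K⊆J′ : K ⊆J J′
    K⊆J′ h′ K∋h′ with sameHex h h′ in h′≟h
    ... | false = trans (cong (_xor false) (K⊆J h′ K∋h′)) refl
    ... | true with sameHex-true {h} {h′} h′≟h
    ...   | refl = contradiction (trans (sym K∋h′) K∌h) λ ()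
    smaller : count (I J′) < count (I J)
    smaller = count-strict J′⊆J h J′∌h J∋h
    rest : ∀ n → count (I J) ≤ n → Star Step (matchingOf J′) (matchingOf K)
    rest zero    size≤0 = ⊥-elim (<⇒≱ (≤-<-trans z≤n smaller) size≤0)
    rest (suc n) size≤n = flips n J′ K K⊆J′ (≤-pred (≤-trans smaller size≤n))

  idealOf-mono : ∀ {P₁ P₂} → P₁ ≼ P₂ → idealOf P₁ ⊆J idealOf P₂
  idealOf-mono ε                      h t = t
  idealOf-mono (inj₁ P≈Q ◅ path)      h t = trans (idealOf-cong P≈Q h) (idealOf-mono path h t)
  idealOf-mono (inj₂ arc ◅ path)      h t = arc-shrinks arc h (idealOf-mono path h t)

  idealOf-reflects : ∀ {P₁ P₂} → idealOf P₁ ⊆J idealOf P₂ → P₁ ≼ P₂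
  idealOf-reflects {P₁} {P₂} f₁⊆f₂ =
    inj₁ (matching-determined P₂) ◅
      (flips _ (idealOf P₂) (idealOf P₁) f₁⊆f₂ ≤-refl ◅◅
       (inj₁ (λ e → sym (matching-determined P₁ e)) ◅ ε))

theorem4p6 : (m : ℕ) (r : Fin m → ℕ) → 1 ≤ m →
             (∀ i j → toℕ i ≤ toℕ j → r j ≤ r i) → (∀ i → 1 ≤ r i) →
             ∃ λ (f : L.PerfectMatching m r → L.Ideal m r) →
               IsOrderIsomorphism (L._≈M_ m r) (L._≈J_ m r) (L._≼_ m r) (L._⊆J_ m r) f
theorem4p6 m r _ r-antitone r-positive = idealOf , record
  { isOrderMonomorphism = record
    { isOrderHomomorphism = record { cong = idealOf-cong ; mono = idealOf-mono }
    ; injective           = idealOf-injective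
    ; cancel              = idealOf-reflects
    }
  ; surjective = λ J → matchingOf J , λ P≈ h → trans (idealOf-cong P≈ h) (idealOf-matchingOf J h)
  }
  where open Staircase m r r-antitone r-positive
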